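{- Let $R$ be a unique factorization domain with quotient field $Q(R)$, let $f(s)=\frac{a_m}{m^s}+\cdots+\frac{a_n}{n^s}$ be an algebraically primitive Dirichlet polynomial with coefficients in $R$, $a_ma_n\neq0$, and let $p$ be a prime element of $R$. Suppose that $p\nmid a_k$ for some index $k<m\,\delta(m,n)$, that $p\mid a_j$ for all $j\ge m\,\delta(m,n)$, and that $$\rho(m,n)<\left(\frac{n}{i}\right)^{\frac{1}{\nu_p(a_n)-\nu_p(a_i)}}\quad\text{for all } i<n \text{ with } \nu_p(a_i)<\nu_p(a_n).$$ Then for any nonzero elements $b_m,\dots,b_n\in R$ with $p\nmid b_kb_n$, the Dirichlet polynomial $g(s)=\frac{a_mb_m}{m^s}+\cdots+\frac{a_nb_n}{n^s}$ is irreducible over $Q(R)$.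
   Context: Dirichlet polynomials are multiplied by the Dirichlet product $\left(\sum_j\frac{b_j}{j^s}\right)\left(\sum_k\frac{c_k}{k^s}\right)=\sum_i\frac{\sum_{jk=i}b_jc_k}{i^s}$; constant means supported on $\{1\}$; algebraically primitive means the indices with nonzero coefficient have gcd $1$. $\nu_p$ is the $p$-adic valuation with $\nu_p(0)=+\infty$. For integers $1\le m<n$: $\rho(m,n)=\max\{\frac dc: d\mid n,\ c\mid m,\ \frac dc\le\sqrt{n/m}\}$ and $\delta(m,n)=\min\{\frac dc: d\mid n,\ c\mid m,\ d>c>0\}$. Irreducible over $Q(R)$: not a product of two nonconstant Dirichlet polynomials with coefficients in $Q(R)$. -}

module Defs where

open import Level using (_⊔_)
open import Algebra.Bundles using (CommutativeRing; Semiring)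
open import Data.Nat as ℕ using (ℕ; zero; suc; _≤_; _<_)
open import Data.Nat.Divisibility as ℕD using ()
open import Data.Product using (Σ; ∃; _×_; _,_)
open import Data.Sum using (_⊎_)
open import Data.Bool using (if_then_else_)
open import Data.List using (List; foldr)
open import Data.List.Relation.Unary.All using (All)
open import Data.List.Relation.Binary.Pointwise using (Pointwise)
open import Data.List.Relation.Binary.Permutation.Propositional using (_↭_)
open import Relation.Nullary using (¬_; does)
open import Relation.Binary.PropositionalEquality using (_≡_)

-- (d , c) is a pair realising δ(m,n) = min { d/c : d ∣ n, c ∣ m, d > c > 0 }.
-- Comparison of fractions d/c ≤ d'/c' is written d * c' ≤ d' * c.
IsDelta : ℕ → ℕ → ℕ → ℕ → Set
IsDelta m n d c =
  (d ℕD.∣ n) × (c ℕD.∣ m) × (0 < c) × (c < d) ×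
  (∀ d' c' → d' ℕD.∣ n → c' ℕD.∣ m → 0 < c' → c' < d' → d ℕ.* c' ≤ d' ℕ.* c)

-- (d , c) is a pair realising ρ(m,n) = max { d/c : d ∣ n, c ∣ m, d/c ≤ √(n/m) }.
-- d/c ≤ √(n/m)  ⇔  d² m ≤ c² n  (all quantities positive).
IsRho : ℕ → ℕ → ℕ → ℕ → Set
IsRho m n d c =
  (d ℕD.∣ n) × (c ℕD.∣ m) × (0 < c) × (d ℕ.* d ℕ.* m ≤ c ℕ.* c ℕ.* n) ×
  (∀ d' c' → d' ℕD.∣ n → c' ℕD.∣ m → 0 < c' → d' ℕ.* d' ℕ.* m ≤ c' ℕ.* c' ℕ.* n →
     d' ℕ.* c ≤ d ℕ.* c')

module RingDefs {c ℓ} (R : CommutativeRing c ℓ) where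
  open CommutativeRing R public
    using (Carrier; semiring)
    renaming (_≈_ to _≈ᴿ_; _+_ to _⊕_; _*_ to _·_; 0# to 0ᴿ; 1# to 1ᴿ)
  open import Algebra.Definitions.RawSemiring (Semiring.rawSemiring semiring) public
    using (_∣_; _∤_; Prime; Irreducible) renaming (_^_ to _^ᴿ_)

  _≉ᴿ_ : Carrier → Carrier → Set ℓ
  x ≉ᴿ y = ¬ (x ≈ᴿ y)

  Unit : Carrier → Set (c ⊔ ℓ)
  Unit x = x ∣ 1ᴿ

  Associated : Carrier → Carrier → Set (c ⊔ ℓ)
  Associated x y = (x ∣ y) × (y ∣ x)

  prod : List Carrier → Carrier
  prod = foldr _·_ 1ᴿ

  IsIntegralDomain : Set (c ⊔ ℓ)
  IsIntegralDomain = (1ᴿ ≉ᴿ 0ᴿ) × (∀ x y → (x · y) ≈ᴿ 0ᴿ → (x ≈ᴿ 0ᴿ) ⊎ (y ≈ᴿ 0ᴿ))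

  IsUFD : Set (c ⊔ ℓ)
  IsUFD =
    IsIntegralDomain ×
    (∀ x → x ≉ᴿ 0ᴿ → ¬ Unit x → ∃ λ (xs : List Carrier) → All Irreducible xs × (x ≈ᴿ prod xs)) ×
    (∀ (xs ys : List Carrier) → All Irreducible xs → All Irreducible ys → prod xs ≈ᴿ prod ys →
       ∃ λ (zs : List Carrier) → (xs ↭ zs) × Pointwise Associated zs ys)

  -- ν_p(x) = e  (for x ≠ 0; no e satisfies this when x = 0, i.e. ν_p(0) = +∞)
  IsVal : Carrier → Carrier → ℕ → Set (c ⊔ ℓ)
  IsVal p x e = ((p ^ᴿ e) ∣ x) × ((p ^ᴿ suc e) ∤ x)

  AlgPrimitive : ℕ → ℕ → (ℕ → Carrier) → Set ℓ
  AlgPrimitive m n a =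
    ∀ d → (∀ j → m ≤ j → j ≤ n → a j ≉ᴿ 0ᴿ → d ℕD.∣ j) → d ≡ 1

  -- The quotient field Q(R): fractions num/den (den ≠ 0), with the usual
  -- equality a/b ≈ c/d ⇔ a d ≈ c b and the usual operations.

  Frac : Set c
  Frac = Carrier × Carrier

  ValidFrac : Frac → Set ℓ
  ValidFrac (_ , b) = b ≉ᴿ 0ᴿ

  _≈Q_ : Frac → Frac → Set ℓ
  (a , b) ≈Q (c' , d) = (a · d) ≈ᴿ (c' · b)

  _+Q_ : Frac → Frac → Frac
  (a , b) +Q (c' , d) = ((a · d) ⊕ (c' · b)) , (b · d)

  _*Q_ : Frac → Frac → Frac
  (a , b) *Q (c' , d) = (a · c') , (b · d)

  0Q : Frac
  0Q = 0ᴿ , 1ᴿ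

  ι : Carrier → Frac
  ι a = a , 1ᴿ

  sumQ : ℕ → (ℕ → Frac) → Frac
  sumQ zero    f = f zero
  sumQ (suc i) f = sumQ i f +Q f (suc i)

  -- Dirichlet product: (F ⋆ G)_i = Σ_{j k = i} F_j G_k  (j, k ≤ i suffice for i ≥ 1)
  _⋆_ : (ℕ → Frac) → (ℕ → Frac) → ℕ → Frac
  (F ⋆ G) i = sumQ i λ j → sumQ i λ k →
                if does (j ℕ.* k ℕ.≟ i) then F j *Q G k else 0Q

  -- A Dirichlet polynomial with coefficients in Q(R): coefficients indexed by
  -- positive integers (index 0 unused, set to 0), finitely many nonzero.
  IsDirPolyQ : (ℕ → Frac) → Set ℓ
  IsDirPolyQ F = (∀ i → ValidFrac (F i)) × (F 0 ≈Q 0Q) ×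
                 (∃ λ N → ∀ i → N < i → F i ≈Q 0Q)

  -- nonconstant: not supported on {1}
  NonConstantQ : (ℕ → Frac) → Set ℓ
  NonConstantQ F = ∃ λ i → (2 ≤ i) × ¬ (F i ≈Q 0Q)

  IrreducibleOverQ : (ℕ → Carrier) → Set (c ⊔ ℓ)
  IrreducibleOverQ g =
    ¬ (Σ (ℕ → Frac) λ F → Σ (ℕ → Frac) λ G →
         IsDirPolyQ F × IsDirPolyQ G × NonConstantQ F × NonConstantQ G ×
         (∀ i → 1 ≤ i → ι (g i) ≈Q (F ⋆ G) i))

{-# OPTIONS --safe #-}
module Submission where

-- Suppose g = Σ aⱼbⱼ/jˢ factors over Q(R). Clearing denominators gives C · g = X ⋆ Y with C ≠ 0 and
-- X, Y nonconstant over R; the products of their first and of their last indices are m and n.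
-- Compare p-adic valuations of the coefficients of C · g with those forced by X and Y:
-- * The last indices of minimal valuation in X and Y multiply to an index i* with p ∤ a_{i*}, so
--   i* < m δ. If the last coefficient of X had minimal valuation, then either X is a monomial,
--   against primitivity, or last/first ≥ δ in X pushes i* up to m δ.
-- * Otherwise take X with the smaller ratio last/first; it is at most √(n/m), hence at most ρ.
--   In each factor the leftmost index minimising ρ^ν(j) / j (a vertex of the Newton polygon)
--   gives an index i < n where C · g has exactly the predicted valuation, and comparing with the
--   last coefficient yields ρ^(ν_p(a_n) − ν_p(a_i)) ≥ n / i, against the hypothesis on ρ.
-- Valuations exist only under double negation in a UFD, so the argument runs inside ¬¬.

open import Defs
open import Algebra.Bundles using (CommutativeRing)
open import Algebra.Definitions.RawMagma using (_,_)
import Algebra.Properties.CommutativeSemigroup as CommutativeSemigroupProperties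
import Algebra.Properties.CommutativeSemigroup.Divisibility as CommutativeSemigroupDivisibility
import Algebra.Properties.Ring as RingProperties
import Algebra.Properties.Semiring.Divisibility as SemiringDivisibility
import Algebra.Properties.Semiring.Exp as SemiringExp
open import Data.Bool using (true; false; if_then_else_)
open import Data.Empty using (⊥; ⊥-elim)
open import Data.List using (List; []; _∷_; _++_; length; replicate)
import Data.List.Properties as List
open import Data.List.Relation.Binary.Permutation.Propositional.Properties using (↭-length)
open import Data.List.Relation.Binary.Pointwise using (Pointwise-length)
open import Data.List.Relation.Unary.All using (All; _∷_)
import Data.List.Relation.Unary.All.Properties as All
open import Data.Nat as ℕ using (ℕ; zero; suc; _+_; _*_; _^_; _∸_; _≤_; _<_; z≤n; s≤s; _≟_; _≤?_; _<?_)
import Data.Nat.Divisibility as ℕD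
import Data.Nat.Properties as ℕP
open import Data.Nat.Solver using (module +-*-Solver)
open import Data.Product using (Σ; ∃; _×_; _,_; proj₁; proj₂)
open import Data.Sum as Sum using (_⊎_; inj₁; inj₂; [_,_])
open import Function using (id; flip; case_of_)
open import Level using (_⊔_)
open import Relation.Nullary using (¬_; Dec; yes; no; does; contradiction)
open import Relation.Nullary.Decidable using (dec-true; dec-false; decidable-stable; ¬¬-excluded-middle)
open import Relation.Nullary.Negation using (DoubleNegation)
open import Relation.Unary using (Pred; Decidable)
open import Relation.Binary.PropositionalEquality as ≡ using (_≡_; _≢_)

open +-*-Solver using (solve; _:*_; _:=_)

below-suc : ∀ {p} {P : ℕ → Set p} {N} → (∀ j → j < N → P j) → P N → ∀ j → j < suc N → P j
below-suc below top j j<1+N with ℕP.m<1+n⇒m<n∨m≡n j<1+N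
... | inj₁ j<N    = below j j<N
... | inj₂ ≡.refl = top

¬¬-∀< : ∀ {a} {Q : ℕ → Set a} → (∀ j → DoubleNegation (Q j)) → ∀ N → DoubleNegation (∀ j → j < N → Q j)
¬¬-∀< ¬¬Q zero    k = k λ _ ()
¬¬-∀< ¬¬Q (suc N) k = ¬¬-∀< ¬¬Q N λ below → ¬¬Q N λ top → k (below-suc below top)

record Least {s} (S : Pred ℕ s) (_⊑_ : ℕ → ℕ → Set) : Set s where
  constructor least-by
  field
    min   : ℕ
    min∈  : S min
    min-⊑ : ∀ {j} → S j → min ⊑ j

module _ {s} {S : Pred ℕ s} (S? : Decidable S) {_⊑_ : ℕ → ℕ → Set}
         (⊑-trans : ∀ {x y z} → S x → S y → S z → x ⊑ y → y ⊑ z → x ⊑ z)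
         (⊑-total : ∀ {x y} → S x → S y → x ⊑ y ⊎ y ⊑ x) where

  private
    ⊑-refl : ∀ {x} → S x → x ⊑ x
    ⊑-refl sx = [ id , id ] (⊑-total sx sx)

    least-below : ∀ N → (∀ j → j < N → ¬ S j) ⊎ ∃ λ j₀ → S j₀ × ∀ j → j < N → S j → j₀ ⊑ j
    least-below zero = inj₁ λ _ ()
    least-below (suc N) with least-below N | S? N
    ... | inj₁ none | no ¬sN = inj₁ (below-suc none ¬sN)
    ... | inj₁ none | yes sN = inj₂ (N , sN , below-suc (λ j j<N sj → contradiction sj (none j j<N)) (λ _ → ⊑-refl sN))
    ... | inj₂ (j₀ , s₀ , min) | no ¬sN = inj₂ (j₀ , s₀ , below-suc min (λ sN → contradiction sN ¬sN))
    ... | inj₂ (j₀ , s₀ , min) | yes sN with ⊑-total s₀ sN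
    ...   | inj₁ j₀⊑N = inj₂ (j₀ , s₀ , below-suc min (λ _ → j₀⊑N))
    ...   | inj₂ N⊑j₀ = inj₂ (N , sN , below-suc (λ j j<N sj → ⊑-trans sN s₀ sj N⊑j₀ (min j j<N sj)) (λ _ → ⊑-refl sN))

  opaque
    least : ∀ N → (∀ {j} → S j → j ≤ N) → ∀ {j} → S j → Least S _⊑_
    least N bounded {j} sj with least-below (suc N)
    ... | inj₁ none = contradiction sj (none j (s≤s (bounded sj)))
    ... | inj₂ (j₀ , s₀ , min) = least-by j₀ s₀ λ {j} sj → min j (s≤s (bounded sj)) sj

Lex : (ℕ → ℕ → Set) → (ℕ → ℕ → Set) → ℕ → ℕ → Set
Lex _≤₁_ _≤₂_ x y = x ≤₁ y × (y ≤₁ x → x ≤₂ y)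

module _ {s} {S : Pred ℕ s} {_≤₁_ _≤₂_ : ℕ → ℕ → Set} where

  Lex-trans : (∀ {x y z} → S x → S y → S z → x ≤₁ y → y ≤₁ z → x ≤₁ z) →
              (∀ {x y z} → x ≤₂ y → y ≤₂ z → x ≤₂ z) →
              ∀ {x y z} → S x → S y → S z → Lex _≤₁_ _≤₂_ x y → Lex _≤₁_ _≤₂_ y z → Lex _≤₁_ _≤₂_ x z
  Lex-trans ≤₁-trans ≤₂-trans sx sy sz (x≼y , x⊴y) (y≼z , y⊴z) =
    ≤₁-trans sx sy sz x≼y y≼z ,
    λ z≼x → ≤₂-trans (x⊴y (≤₁-trans sy sz sx y≼z z≼x)) (y⊴z (≤₁-trans sz sx sy z≼x x≼y))

  Lex-total : (∀ x y → Dec (x ≤₁ y)) → (∀ {x y} → S x → S y → x ≤₁ y ⊎ y ≤₁ x) → (∀ x y → x ≤₂ y ⊎ y ≤₂ x) →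
              ∀ {x y} → S x → S y → Lex _≤₁_ _≤₂_ x y ⊎ Lex _≤₁_ _≤₂_ y x
  Lex-total _≤₁?_ ≤₁-total ≤₂-total {x} {y} sx sy with y ≤₁? x | x ≤₁? y
  ... | no y⋠x | _ = inj₁ ([ id , (λ y≼x → contradiction y≼x y⋠x) ] (≤₁-total sx sy) , λ y≼x → contradiction y≼x y⋠x)
  ... | yes y≼x | no x⋠y = inj₂ (y≼x , λ x≼y → contradiction x≼y x⋠y)
  ... | yes y≼x | yes x≼y = Sum.map (λ x⊴y → x≼y , λ _ → x⊴y) (λ y⊴x → y≼x , λ _ → y⊴x) (≤₂-total x y)

1≤m*n⇒m≤m*n : ∀ m n → 1 ≤ m * n → m ≤ m * n
1≤m*n⇒m≤m*n m zero    1≤m*0 = contradiction (≡.subst (1 ≤_) (ℕP.*-zeroʳ m) 1≤m*0) λ ()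
1≤m*n⇒m≤m*n m (suc n) _     = ℕP.m≤m*n m (suc n)

1≤m*n⇒n≤m*n : ∀ m n → 1 ≤ m * n → n ≤ m * n
1≤m*n⇒n≤m*n m n 1≤m*n = ≡.subst (n ≤_) (ℕP.*-comm n m) (1≤m*n⇒m≤m*n n m (≡.subst (1 ≤_) (ℕP.*-comm m n) 1≤m*n))

*-≤-tight : ∀ {a b j k} → a ≤ j → b ≤ k → j * k ≡ a * b → 1 ≤ a → 1 ≤ b → j ≡ a × k ≡ b
*-≤-tight {a} {b} {j} {k} a≤j b≤k jk=ab 1≤a 1≤b with ℕP.m≤n⇒m<n∨m≡n a≤j | ℕP.m≤n⇒m<n∨m≡n b≤k
... | inj₂ ≡.refl | inj₂ ≡.refl = ≡.refl , ≡.refl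
... | inj₁ a<j  | _         = contradiction (≡.sym jk=ab)
    (ℕP.<⇒≢ (ℕP.<-≤-trans (ℕP.*-monoˡ-< b {{ℕ.>-nonZero 1≤b}} a<j) (ℕP.*-monoʳ-≤ j b≤k)))
... | inj₂ ≡.refl | inj₁ b<k  = contradiction (≡.sym jk=ab) (ℕP.<⇒≢ (ℕP.*-monoʳ-< a {{ℕ.>-nonZero 1≤a}} b<k))

*-≡⇒<⊎< : ∀ {j k j₀ k₀} → j * k ≡ j₀ * k₀ → 1 ≤ j₀ → 1 ≤ k₀ → ¬ (j ≡ j₀ × k ≡ k₀) → j < j₀ ⊎ k < k₀
*-≡⇒<⊎< {j} {k} {j₀} {k₀} jk=j₀k₀ 1≤j₀ 1≤k₀ ≢ with j₀ ≤? j | k₀ ≤? k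
... | yes j₀≤j | yes k₀≤k = contradiction (*-≤-tight j₀≤j k₀≤k jk=j₀k₀ 1≤j₀ 1≤k₀) ≢
... | no j₀≰j  | _        = inj₁ (ℕP.≰⇒> j₀≰j)
... | yes _    | no k₀≰k  = inj₂ (ℕP.≰⇒> k₀≰k)

δ-bound : ∀ {m dδ cδ u v U V} → u * v ≡ m → dδ * u ≤ U * cδ → v ≤ V → m * dδ ≤ U * V * cδ
δ-bound {dδ = dδ} {cδ} {u} {v} {U} {V} ≡.refl du≤Uc v≤V = begin
  u * v * dδ       ≡⟨ solve 3 (λ u v d → u :* v :* d := d :* u :* v) ≡.refl u v dδ ⟩
  dδ * u * v       ≤⟨ ℕP.*-mono-≤ du≤Uc v≤V ⟩
  U * cδ * V       ≡⟨ solve 3 (λ U c V → U :* c :* V := U :* V :* c) ≡.refl U cδ V ⟩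
  U * V * cδ       ∎
  where open ℕP.≤-Reasoning

ρ-admissible : ∀ {m n u v U V} → u * v ≡ m → U * V ≡ n → U * v ≤ u * V → U * U * m ≤ u * u * n
ρ-admissible {u = u} {v} {U} {V} ≡.refl ≡.refl Uv≤uV = begin
  U * U * (u * v)     ≡⟨ solve 4 (λ U u v V → U :* U :* (u :* v) := U :* v :* (u :* U)) ≡.refl U u v V ⟩
  U * v * (u * U)     ≤⟨ ℕP.*-monoˡ-≤ (u * U) Uv≤uV ⟩
  u * V * (u * U)     ≡⟨ solve 4 (λ U u v V → u :* V :* (u :* U) := u :* u :* (U :* V)) ≡.refl U u v V ⟩
  u * u * (U * V)     ∎
  where open ℕP.≤-Reasoning

-- A pair (a , b) stands for the fraction a / b; b is positive wherever it matters.

infix 4 _≼_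
_≼_ : ℕ × ℕ → ℕ × ℕ → Set
(a , b) ≼ (a′ , b′) = a * b′ ≤ a′ * b

infixl 7 _⊗_
_⊗_ : ℕ × ℕ → ℕ × ℕ → ℕ × ℕ
(a , b) ⊗ (a′ , b′) = a * a′ , b * b′

_≼?_ : ∀ x y → Dec (x ≼ y)
(a , b) ≼? (a′ , b′) = a * b′ ≤? a′ * b

≼-total : ∀ x y → x ≼ y ⊎ y ≼ x
≼-total (a , b) (a′ , b′) = ℕP.≤-total (a * b′) (a′ * b)

*-cancelˡ-≤′ : ∀ {m n} o → 0 < o → o * m ≤ o * n → m ≤ n
*-cancelˡ-≤′ o@(suc _) _ = ℕP.*-cancelˡ-≤ o

≼-trans : ∀ {x y z} → 0 < proj₂ y → x ≼ y → y ≼ z → x ≼ z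
≼-trans {a , b} {a′ , b′} {a″ , b″} b′>0 x≼y y≼z = *-cancelˡ-≤′ b′ b′>0 (begin
  b′ * (a * b″)   ≡⟨ solve 3 (λ a b′ b″ → b′ :* (a :* b″) := (a :* b′) :* b″) ≡.refl a b′ b″ ⟩
  a * b′ * b″     ≤⟨ ℕP.*-monoˡ-≤ b″ x≼y ⟩
  a′ * b * b″     ≡⟨ solve 3 (λ a′ b b″ → a′ :* b :* b″ := (a′ :* b″) :* b) ≡.refl a′ b b″ ⟩
  a′ * b″ * b     ≤⟨ ℕP.*-monoˡ-≤ b y≼z ⟩
  a″ * b′ * b     ≡⟨ solve 3 (λ a″ b′ b → a″ :* b′ :* b := b′ :* (a″ :* b)) ≡.refl a″ b′ b ⟩
  b′ * (a″ * b)   ∎)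
  where open ℕP.≤-Reasoning

⊗-interchange : ∀ a b c d → (a * c) * (b * d) ≡ (a * b) * (c * d)
⊗-interchange = solve 4 (λ a b c d → (a :* c) :* (b :* d) := (a :* b) :* (c :* d)) ≡.refl

⊗-mono-≼ : ∀ {x x′ y y′} → x ≼ x′ → y ≼ y′ → x ⊗ y ≼ x′ ⊗ y′
⊗-mono-≼ {a , b} {a′ , b′} {c , d} {c′ , d′} x≼x′ y≼y′ = begin
  a * c * (b′ * d′)   ≡⟨ ⊗-interchange a b′ c d′ ⟩
  a * b′ * (c * d′)   ≤⟨ ℕP.*-mono-≤ x≼x′ y≼y′ ⟩
  a′ * b * (c′ * d)   ≡⟨ ≡.sym (⊗-interchange a′ b c′ d) ⟩
  a′ * c′ * (b * d)   ∎
  where open ℕP.≤-Reasoning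

⊗-mono-≺-≼ : ∀ {x x′ y y′} → ¬ x′ ≼ x → y ≼ y′ → 0 < proj₁ y′ → 0 < proj₂ y → ¬ x′ ⊗ y′ ≼ x ⊗ y
⊗-mono-≺-≼ {a , b} {a′ , b′} {c , d} {c′ , d′} x′⋠x y≼y′ c′>0 d>0 = ℕP.<⇒≱ (begin-strict
  a * c * (b′ * d′)   ≡⟨ ⊗-interchange a b′ c d′ ⟩
  a * b′ * (c * d′)   ≤⟨ ℕP.*-monoʳ-≤ (a * b′) y≼y′ ⟩
  a * b′ * (c′ * d)   <⟨ ℕP.*-monoˡ-< (c′ * d) {{ℕ.>-nonZero (ℕP.*-mono-< c′>0 d>0)}} (ℕP.≰⇒> x′⋠x) ⟩
  a′ * b * (c′ * d)   ≡⟨ ≡.sym (⊗-interchange a′ b c′ d) ⟩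
  a′ * c′ * (b * d)   ∎)
  where open ℕP.≤-Reasoning

⊗-comm : ∀ x y → x ⊗ y ≡ y ⊗ x
⊗-comm (a , b) (a′ , b′) = ≡.cong₂ _,_ (ℕP.*-comm a a′) (ℕP.*-comm b b′)

⊗-mono-≼-≺ : ∀ {x x′ y y′} → x ≼ x′ → ¬ y′ ≼ y → 0 < proj₁ x′ → 0 < proj₂ x → ¬ x′ ⊗ y′ ≼ x ⊗ y
⊗-mono-≼-≺ {x} {x′} {y} {y′} x≼x′ y′⋠y a′>0 b>0 =
  ≡.subst₂ (λ u v → ¬ u ≼ v) (⊗-comm y′ x′) (⊗-comm y x) (⊗-mono-≺-≼ {y} {y′} {x} {x′} y′⋠y x≼x′ a′>0 b>0)

⊗-cancelˡ-≼ : ∀ {x y} z → 0 < proj₁ z → 0 < proj₂ z → z ⊗ x ≼ z ⊗ y → x ≼ y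
⊗-cancelˡ-≼ {a , b} {a′ , b′} (e , f) e>0 f>0 zx≼zy = *-cancelˡ-≤′ (e * f) (ℕP.*-mono-< e>0 f>0) (begin
  e * f * (a * b′)   ≡⟨ ⊗-interchange e a f b′ ⟩
  e * a * (f * b′)   ≤⟨ zx≼zy ⟩
  e * a′ * (f * b)   ≡⟨ ≡.sym (⊗-interchange e a′ f b) ⟩
  e * f * (a′ * b)   ∎)
  where open ℕP.≤-Reasoning

module Weights {d c : ℕ} (c>0 : 0 < c) (c≤d : c ≤ d) where
  open ℕP.≤-Reasoning

  d>0 : 0 < d
  d>0 = ℕP.<-≤-trans c>0 c≤d

  d^>0 : ∀ e → 0 < d ^ e
  d^>0 = ℕP.m^n>0 d {{ℕ.>-nonZero d>0}}

  c^>0 : ∀ e → 0 < c ^ e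
  c^>0 = ℕP.m^n>0 c {{ℕ.>-nonZero c>0}}

  -- ρ ^ e / j for ρ = d / c ≥ 1: a coefficient of valuation e at index j
  weight : ℕ → ℕ → ℕ × ℕ
  weight e j = d ^ e , c ^ e * j

  weight-⊗ : ∀ a j b k → weight a j ⊗ weight b k ≡ weight (a + b) (j * k)
  weight-⊗ a j b k = ≡.cong₂ _,_ (≡.sym (ℕP.^-distribˡ-+-* d a b)) (begin-equality
    c ^ a * j * (c ^ b * k)   ≡⟨ ⊗-interchange (c ^ a) (c ^ b) j k ⟩
    c ^ a * c ^ b * (j * k)   ≡⟨ ≡.cong (_* (j * k)) (≡.sym (ℕP.^-distribˡ-+-* c a b)) ⟩
    c ^ (a + b) * (j * k)     ∎)

  ρ^-mono : ∀ {A B} → A ≤ B → d ^ A * c ^ B ≤ d ^ B * c ^ A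
  ρ^-mono {A} A≤B with ℕP.m≤n⇒∃[o]m+o≡n A≤B
  ... | t , ≡.refl = begin
    d ^ A * c ^ (A + t)       ≡⟨ ≡.cong (d ^ A *_) (ℕP.^-distribˡ-+-* c A t) ⟩
    d ^ A * (c ^ A * c ^ t)   ≤⟨ ℕP.*-monoʳ-≤ (d ^ A) (ℕP.*-monoʳ-≤ (c ^ A) (ℕP.^-monoˡ-≤ t c≤d)) ⟩
    d ^ A * (c ^ A * d ^ t)   ≡⟨ solve 3 (λ x y z → x :* (y :* z) := (x :* z) :* y) ≡.refl (d ^ A) (c ^ A) (d ^ t) ⟩
    d ^ A * d ^ t * c ^ A     ≡⟨ ≡.cong (_* c ^ A) (≡.sym (ℕP.^-distribˡ-+-* d A t)) ⟩
    d ^ (A + t) * c ^ A       ∎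

  weight-monoˡ-≼ : ∀ {A B} j → A ≤ B → weight A j ≼ weight B j
  weight-monoˡ-≼ {A} {B} j A≤B = begin
    d ^ A * (c ^ B * j)   ≡⟨ ≡.sym (ℕP.*-assoc (d ^ A) (c ^ B) j) ⟩
    d ^ A * c ^ B * j     ≤⟨ ℕP.*-monoˡ-≤ j (ρ^-mono A≤B) ⟩
    d ^ B * c ^ A * j     ≡⟨ ℕP.*-assoc (d ^ B) (c ^ A) j ⟩
    d ^ B * (c ^ A * j)   ∎

  weight-step : ∀ {μ α u U j} → μ < α → c * U ≤ d * u → u ≤ j → weight μ j ≼ weight α U
  weight-step {μ} {u = u} {U} {j} μ<α cU≤du u≤j with ℕP.m≤n⇒∃[o]m+o≡n μ<α
  ... | t , ≡.refl = begin
    d ^ μ * (c ^ (suc μ + t) * U)       ≡⟨ ≡.cong (λ x → d ^ μ * (x * U)) (ℕP.^-distribˡ-+-* c (suc μ) t) ⟩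
    d ^ μ * (c * c ^ μ * c ^ t * U)     ≡⟨ solve 5 (λ x c y z U → x :* (c :* y :* z :* U) := x :* y :* (z :* (c :* U)))
                                                ≡.refl (d ^ μ) c (c ^ μ) (c ^ t) U ⟩
    d ^ μ * c ^ μ * (c ^ t * (c * U))   ≤⟨ ℕP.*-monoʳ-≤ (d ^ μ * c ^ μ)
                                             (ℕP.*-mono-≤ (ℕP.^-monoˡ-≤ t c≤d) (ℕP.≤-trans cU≤du (ℕP.*-monoʳ-≤ d u≤j))) ⟩
    d ^ μ * c ^ μ * (d ^ t * (d * j))   ≡⟨ solve 5 (λ x y z d j → x :* y :* (z :* (d :* j)) := d :* x :* z :* (y :* j))
                                                ≡.refl (d ^ μ) (c ^ μ) (d ^ t) d j ⟩
    d * d ^ μ * d ^ t * (c ^ μ * j)     ≡⟨ ≡.cong (_* (c ^ μ * j)) (≡.sym (ℕP.^-distribˡ-+-* d (suc μ) t)) ⟩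
    d ^ (suc μ + t) * (c ^ μ * j)       ∎

  weight-cancelˡ : ∀ κ {x e i n} → weight (κ + x) i ≼ weight (κ + e) n → weight x i ≼ weight e n
  weight-cancelˡ κ {x} {e} {i} {n} h =
    ⊗-cancelˡ-≼ (weight κ 1) (d^>0 κ) (ℕP.*-mono-< (c^>0 κ) (s≤s z≤n))
      (≡.subst₂ _≼_ (≡.sym (split x i)) (≡.sym (split e n)) h)
    where
      split : ∀ y j → weight κ 1 ⊗ weight y j ≡ weight (κ + y) j
      split y j = ≡.trans (weight-⊗ κ 1 y j) (≡.cong (weight (κ + y)) (ℕP.*-identityˡ j))

  weight-≼⇒< : ∀ {x e i n} → i < n → weight x i ≼ weight e n → x < e
  weight-≼⇒< {x} {e} {i} {n} i<n h with ℕP.<-≤-connex x e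
  ... | inj₁ x<e = x<e
  ... | inj₂ e≤x = contradiction n≤i (ℕP.<⇒≱ i<n)
    where
      n≤i : n ≤ i
      n≤i = *-cancelˡ-≤′ (c ^ x) (c^>0 x) (*-cancelˡ-≤′ (d ^ x) (d^>0 x)
              (≼-trans {weight x i} {weight e n} {weight x n}
                 (ℕP.*-mono-< (c^>0 e) (ℕP.≤-<-trans z≤n i<n)) h (weight-monoˡ-≼ n e≤x)))

  weight-gap : ∀ {x e i n} → x ≤ e → weight x i ≼ weight e n → c ^ (e ∸ x) * n ≤ d ^ (e ∸ x) * i
  weight-gap {x} {i = i} {n} x≤e h with ℕP.m≤n⇒∃[o]m+o≡n x≤e
  ... | t , ≡.refl = ≡.subst₂ (λ s j → c ^ s * n ≤ d ^ s * j) (≡.sym (ℕP.m+n∸m≡n x t)) (ℕP.*-identityˡ i)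
                     (≡.subst (_≤ d ^ t * (1 * i)) (ℕP.*-identityˡ (c ^ t * n))
                       (weight-cancelˡ x {0} {t} (≡.subst (λ y → weight y i ≼ weight (x + t) n) (≡.sym (ℕP.+-identityʳ x)) h)))

  pow-gap-mono : ∀ {t s n i} → t ≤ s → c ^ t * n ≤ d ^ t * i → c ^ s * n ≤ d ^ s * i
  pow-gap-mono {t} {n = n} {i} t≤s h with ℕP.m≤n⇒∃[o]m+o≡n t≤s
  ... | r , ≡.refl = begin
    c ^ (t + r) * n       ≡⟨ ≡.cong (_* n) (ℕP.^-distribˡ-+-* c t r) ⟩
    c ^ t * c ^ r * n     ≡⟨ solve 3 (λ x y n → x :* y :* n := y :* (x :* n)) ≡.refl (c ^ t) (c ^ r) n ⟩
    c ^ r * (c ^ t * n)   ≤⟨ ℕP.*-mono-≤ (ℕP.^-monoˡ-≤ r c≤d) h ⟩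
    d ^ r * (d ^ t * i)   ≡⟨ solve 3 (λ x y i → y :* (x :* i) := x :* y :* i) ≡.refl (d ^ t) (d ^ r) i ⟩
    d ^ t * d ^ r * i     ≡⟨ ≡.cong (_* i) (≡.sym (ℕP.^-distribˡ-+-* d t r)) ⟩
    d ^ (t + r) * i       ∎

  weight-≼⇒pow-bound : ∀ {x e y i n} → i < n → y ≤ x → weight x i ≼ weight e n →
                       y < e × n * c ^ (e ∸ y) ≤ d ^ (e ∸ y) * i
  weight-≼⇒pow-bound {x} {e} {y} {i} {n} i<n y≤x h =
    ℕP.≤-<-trans y≤x x<e ,
    ≡.subst (_≤ d ^ (e ∸ y) * i) (ℕP.*-comm (c ^ (e ∸ y)) n)
      (pow-gap-mono (ℕP.∸-monoʳ-≤ e y≤x) (weight-gap (ℕP.<⇒≤ x<e) h))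
    where
      x<e : x < e
      x<e = weight-≼⇒< i<n h

module RingLemmas {c ℓ} (R : CommutativeRing c ℓ) where
  open RingDefs R public
  open CommutativeRing R public
    using (setoid; refl; sym; trans; *-cong; *-congˡ; *-congʳ; +-cong; *-assoc; *-comm;
           *-identityˡ; *-identityʳ; zeroˡ; zeroʳ; distribʳ; +-assoc; +-comm; +-identityʳ; -_; -‿cong;
           *-commutativeSemigroup; ring; reflexive)
  open CommutativeSemigroupProperties *-commutativeSemigroup public
    using (interchange; xy∙z≈xz∙y)
  open CommutativeSemigroupDivisibility *-commutativeSemigroup public
    using (∣ʳ-trans; ∣ʳ-respʳ-≈; ∣ʳ-respˡ-≈; x∣ʳyx; x∣xy; x∣ʳy⇒x∣ʳzy)
  open SemiringDivisibility semiring public using (∣ʳ-refl; _∣0; 1∣_; 0∣x⇒x≈0)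
  open SemiringExp semiring public using (^-homo-*)
  open RingProperties ring using (-‿distribˡ-*; //-rightDividesʳ)
  open import Relation.Binary.Reasoning.Setoid setoid public

  ∣-+ : ∀ {d x y} → d ∣ x → d ∣ y → d ∣ (x ⊕ y)
  ∣-+ {d} (q , qd≈x) (r , rd≈y) = q ⊕ r , trans (distribʳ d q r) (+-cong qd≈x rd≈y)

  ∣-‿ : ∀ {d x} → d ∣ x → d ∣ (- x)
  ∣-‿ {d} (q , qd≈x) = - q , trans (sym (-‿distribˡ-* q d)) (-‿cong qd≈x)

  ∣-+-cancelʳ : ∀ {d x y} → d ∣ (x ⊕ y) → d ∣ y → d ∣ x
  ∣-+-cancelʳ {x = x} {y} d∣x+y d∣y = ∣ʳ-respʳ-≈ (//-rightDividesʳ y x) (∣-+ d∣x+y (∣-‿ d∣y))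

  ^-∣-mono : ∀ x {m n} → m ≤ n → (x ^ᴿ m) ∣ (x ^ᴿ n)
  ^-∣-mono x {m} m≤n with ℕP.m≤n⇒∃[o]m+o≡n m≤n
  ... | o , ≡.refl = ∣ʳ-respʳ-≈ (trans (*-comm _ _) (sym (^-homo-* x m o))) (x∣ʳyx (x ^ᴿ m) (x ^ᴿ o))

module IntegralDomainLemmas {c ℓ} (R : CommutativeRing c ℓ) (domain : RingDefs.IsIntegralDomain R) where
  open RingLemmas R public
  open RingProperties ring using (x[y-z]≈xy-xz; x∙y⁻¹≈ε⇒x≈y; x≈y⇒x∙y⁻¹≈ε)

  1≉0 : 1ᴿ ≉ᴿ 0ᴿ
  1≉0 = proj₁ domain

  *-≉0 : ∀ {x y} → x ≉ᴿ 0ᴿ → y ≉ᴿ 0ᴿ → (x · y) ≉ᴿ 0ᴿ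
  *-≉0 {x} {y} x≉0 y≉0 xy≈0 with proj₂ domain x y xy≈0
  ... | inj₁ x≈0 = x≉0 x≈0
  ... | inj₂ y≈0 = y≉0 y≈0

  *-cancelˡ-≉0 : ∀ {a x y} → a ≉ᴿ 0ᴿ → (a · x) ≈ᴿ (a · y) → x ≈ᴿ y
  *-cancelˡ-≉0 {a} {x} {y} a≉0 ax≈ay
    with proj₂ domain a (x ⊕ - y) (trans (x[y-z]≈xy-xz a x y) (x≈y⇒x∙y⁻¹≈ε ax≈ay))
  ... | inj₁ a≈0   = contradiction a≈0 a≉0
  ... | inj₂ x-y≈0 = x∙y⁻¹≈ε⇒x≈y x y x-y≈0

  *-cancelʳ-≉0 : ∀ {a x y} → a ≉ᴿ 0ᴿ → (x · a) ≈ᴿ (y · a) → x ≈ᴿ y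
  *-cancelʳ-≉0 {a} {x} {y} a≉0 xa≈ya = *-cancelˡ-≉0 a≉0 (trans (*-comm a x) (trans xa≈ya (*-comm y a)))

module Valuations {c ℓ} (R : CommutativeRing c ℓ) (domain : RingDefs.IsIntegralDomain R)
                  {p : RingDefs.Carrier R} (p-prime : RingDefs.Prime R p) where
  open IntegralDomainLemmas R domain public
  open Prime p-prime public

  p^≉0 : ∀ e → (p ^ᴿ e) ≉ᴿ 0ᴿ
  p^≉0 zero    = 1≉0
  p^≉0 (suc e) = *-≉0 p≉0 (p^≉0 e)

  ∤-* : ∀ {x y} → p ∤ x → p ∤ y → p ∤ (x · y)
  ∤-* p∤x p∤y p∣xy with split-∣ p∣xy
  ... | inj₁ p∣x = p∤x p∣x
  ... | inj₂ p∣y = p∤y p∣y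

  p^1≈p : (p ^ᴿ 1) ≈ᴿ p
  p^1≈p = *-identityʳ p

  IsVal⇒≉0 : ∀ {x e} → IsVal p x e → x ≉ᴿ 0ᴿ
  IsVal⇒≉0 (_ , p^1+e∤x) x≈0 = p^1+e∤x (∣ʳ-respʳ-≈ (sym x≈0) (_ ∣0))

  IsVal⇒∣ : ∀ {x e f} → IsVal p x e → f ≤ e → (p ^ᴿ f) ∣ x
  IsVal⇒∣ (p^e∣x , _) f≤e = ∣ʳ-trans (^-∣-mono p f≤e) p^e∣x

  IsVal-≤ : ∀ {x e f} → IsVal p x e → (p ^ᴿ f) ∣ x → f ≤ e
  IsVal-≤ {e = e} {f} (_ , p^1+e∤x) p^f∣x with ℕP.≤-<-connex f e
  ... | inj₁ f≤e = f≤e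
  ... | inj₂ e<f = contradiction (∣ʳ-trans (^-∣-mono p e<f) p^f∣x) p^1+e∤x

  IsVal-unique : ∀ {x e f} → IsVal p x e → IsVal p x f → e ≡ f
  IsVal-unique ve vf = ℕP.≤-antisym (IsVal-≤ vf (proj₁ ve)) (IsVal-≤ ve (proj₁ vf))

  IsVal-resp : ∀ {x y e} → x ≈ᴿ y → IsVal p x e → IsVal p y e
  IsVal-resp x≈y (p^e∣x , p^1+e∤x) = ∣ʳ-respʳ-≈ x≈y p^e∣x , λ p^1+e∣y → p^1+e∤x (∣ʳ-respʳ-≈ (sym x≈y) p^1+e∣y)

  ∤⇒IsVal-0 : ∀ {x} → p ∤ x → IsVal p x 0
  ∤⇒IsVal-0 {x} p∤x = (1∣ x) , λ p^1∣x → p∤x (∣ʳ-respˡ-≈ p^1≈p p^1∣x)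

  IsVal-0⇒∤ : ∀ {x} → IsVal p x 0 → p ∤ x
  IsVal-0⇒∤ (_ , p^1∤x) p∣x = p^1∤x (∣ʳ-respˡ-≈ (sym p^1≈p) p∣x)

  IsVal-+ : ∀ {x y e} → IsVal p x e → (p ^ᴿ suc e) ∣ y → IsVal p (x ⊕ y) e
  IsVal-+ {e = e} (p^e∣x , p^1+e∤x) p^1+e∣y =
    ∣-+ p^e∣x (∣ʳ-trans (^-∣-mono p (ℕP.n≤1+n e)) p^1+e∣y) ,
    λ p^1+e∣x+y → p^1+e∤x (∣-+-cancelʳ p^1+e∣x+y p^1+e∣y)

  cofactor : ∀ {x e} → IsVal p x e → ∃ λ x′ → p ∤ x′ × (x′ · (p ^ᴿ e)) ≈ᴿ x
  cofactor {x} {e} ((x′ , x′p^e≈x) , p^1+e∤x) = x′ , p∤x′ , x′p^e≈x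
    where
      p∤x′ : p ∤ x′
      p∤x′ (w , wp≈x′) = p^1+e∤x (w , (begin
        w · (p · (p ^ᴿ e))   ≈⟨ *-assoc w p _ ⟨
        (w · p) · (p ^ᴿ e)   ≈⟨ *-congʳ wp≈x′ ⟩
        x′ · (p ^ᴿ e)        ≈⟨ x′p^e≈x ⟩
        x                    ∎))

  IsVal-* : ∀ {x y a b} → IsVal p x a → IsVal p y b → IsVal p (x · y) (a + b)
  IsVal-* {x} {y} {a} {b} vx vy with cofactor {e = a} vx | cofactor {e = b} vy
  ... | x′ , p∤x′ , x′p^a≈x | y′ , p∤y′ , y′p^b≈y = (x′ · y′ , sym xy≈) , p^1+a+b∤xy
    where
      xy≈ : (x · y) ≈ᴿ ((x′ · y′) · (p ^ᴿ (a + b)))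
      xy≈ = begin
        x · y                               ≈⟨ *-cong x′p^a≈x y′p^b≈y ⟨
        (x′ · (p ^ᴿ a)) · (y′ · (p ^ᴿ b))   ≈⟨ interchange x′ _ y′ _ ⟩
        (x′ · y′) · ((p ^ᴿ a) · (p ^ᴿ b))   ≈⟨ *-congˡ (^-homo-* p a b) ⟨
        (x′ · y′) · (p ^ᴿ (a + b))        ∎
      p^1+a+b∤xy : (p ^ᴿ suc (a + b)) ∤ (x · y)
      p^1+a+b∤xy (w , w·p^1+a+b≈xy) = ∤-* p∤x′ p∤y′ (w , *-cancelʳ-≉0 (p^≉0 (a + b)) (begin
        (w · p) · (p ^ᴿ (a + b))   ≈⟨ *-assoc w p _ ⟩
        w · (p ^ᴿ suc (a + b))     ≈⟨ w·p^1+a+b≈xy ⟩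
        x · y                        ≈⟨ xy≈ ⟩
        (x′ · y′) · (p ^ᴿ (a + b)) ∎))

module UFDValuations {c ℓ} (R : CommutativeRing c ℓ) (ufd : RingDefs.IsUFD R)
                     {p : RingDefs.Carrier R} (p-prime : RingDefs.Prime R p) where
  open Valuations R (proj₁ ufd) p-prime public

  private
    factorise : ∀ x → x ≉ᴿ 0ᴿ → ¬ Unit x → ∃ λ xs → All Irreducible xs × x ≈ᴿ prod xs
    factorise = proj₁ (proj₂ ufd)

  factorisation-length-unique : ∀ {xs ys} → All Irreducible xs → All Irreducible ys →
                                prod xs ≈ᴿ prod ys → length xs ≡ length ys
  factorisation-length-unique {xs} {ys} irr-xs irr-ys xs≈ys with proj₂ (proj₂ ufd) xs ys irr-xs irr-ys xs≈ys
  ... | _ , xs↭zs , zs∼ys = ≡.trans (↭-length xs↭zs) (Pointwise-length zs∼ys)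

  prod-++ : ∀ xs ys → prod (xs ++ ys) ≈ᴿ (prod xs · prod ys)
  prod-++ []       ys = sym (*-identityˡ _)
  prod-++ (x ∷ xs) ys = trans (*-congˡ (prod-++ xs ys)) (sym (*-assoc x _ _))

  prod-replicate : ∀ n x → prod (replicate n x) ≈ᴿ (x ^ᴿ n)
  prod-replicate zero    x = refl
  prod-replicate (suc n) x = *-congˡ (prod-replicate n x)

  prime⇒irreducible : Irreducible p
  prime⇒irreducible = record { p∤1 = p∤1 ; split-∣1 = split }
    where
      cofactor-unit : ∀ {x y} → p ≈ᴿ (x · y) → p ∣ x → y ∣ 1ᴿ
      cofactor-unit {x} {y} p≈xy (z , zp≈x) = z , *-cancelˡ-≉0 p≉0 (begin
        p · (z · y)   ≈⟨ *-assoc p z y ⟨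
        (p · z) · y   ≈⟨ *-congʳ (*-comm p z) ⟩
        (z · p) · y   ≈⟨ *-congʳ zp≈x ⟩
        x · y         ≈⟨ p≈xy ⟨
        p             ≈⟨ *-identityʳ p ⟨
        p · 1ᴿ        ∎)
      split : ∀ {x y} → p ≈ᴿ (x · y) → x ∣ 1ᴿ ⊎ y ∣ 1ᴿ
      split {x} {y} p≈xy with split-∣ (1ᴿ , trans (*-identityˡ p) p≈xy)
      ... | inj₁ p∣x = inj₂ (cofactor-unit p≈xy p∣x)
      ... | inj₂ p∣y = inj₁ (cofactor-unit (trans p≈xy (*-comm x y)) p∣y)

  unit*irreducible : ∀ {u r} → Unit u → Irreducible r → Irreducible (u · r)
  unit*irreducible {u} {r} (w , wu≈1) r-irr = record { p∤1 = ur∤1 ; split-∣1 = split }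
    where
      open Irreducible r-irr renaming (p∤1 to r∤1; split-∣1 to r-split)
      ur∤1 : (u · r) ∤ 1ᴿ
      ur∤1 (v , v·ur≈1) = r∤1 (v · u , trans (*-assoc v u r) v·ur≈1)
      split : ∀ {x y} → (u · r) ≈ᴿ (x · y) → x ∣ 1ᴿ ⊎ y ∣ 1ᴿ
      split {x} {y} ur≈xy with r-split (begin
        r             ≈⟨ *-identityˡ r ⟨
        1ᴿ · r        ≈⟨ *-congʳ wu≈1 ⟨
        (w · u) · r   ≈⟨ *-assoc w u r ⟩
        w · (u · r)   ≈⟨ *-congˡ ur≈xy ⟩
        w · (x · y)   ≈⟨ *-assoc w x y ⟨
        (w · x) · y   ∎)
      ... | inj₁ (z , z·wx≈1) = inj₁ (z · w , trans (*-assoc z w x) z·wx≈1)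
      ... | inj₂ y∣1          = inj₂ y∣1

  ¬¬-long-factorisation : ∀ {q} L → q ≉ᴿ 0ᴿ → DoubleNegation (∃ λ ys →
    All Irreducible ys × (q · (p ^ᴿ suc L)) ≈ᴿ prod ys × suc L ≤ length ys)
  ¬¬-long-factorisation {q} L q≉0 k = ¬¬-excluded-middle {A = Unit q} λ where
    (yes q-unit) → k ((q · p) ∷ replicate L p ,
                      unit*irreducible q-unit prime⇒irreducible ∷ All.replicate⁺ L prime⇒irreducible ,
                      trans (sym (*-assoc q p _)) (*-congˡ (sym (prod-replicate L p))) ,
                      s≤s (ℕP.≤-reflexive (≡.sym (List.length-replicate L))))
    (no ¬q-unit) → let qs , irr-qs , q≈qs = factorise q q≉0 ¬q-unit in
                   k (replicate (suc L) p ++ qs ,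
                      All.++⁺ (All.replicate⁺ (suc L) prime⇒irreducible) irr-qs ,
                      (begin
                        q · (p ^ᴿ suc L)                         ≈⟨ *-comm q _ ⟩
                        (p ^ᴿ suc L) · q                         ≈⟨ *-cong (sym (prod-replicate (suc L) p)) q≈qs ⟩
                        prod (replicate (suc L) p) · prod qs     ≈⟨ prod-++ (replicate (suc L) p) qs ⟨
                        prod (replicate (suc L) p ++ qs)         ∎) ,
                      ℕP.≤-trans (ℕP.≤-reflexive (≡.sym (List.length-replicate (suc L))))
                                 (List.length-++-≤ˡ (replicate (suc L) p)))

  -- A factorisation into L irreducibles leaves no room for p ^ (L + 1).
  ¬¬-bounded-multiplicity : ∀ {x} → x ≉ᴿ 0ᴿ → DoubleNegation (∃ λ N → (p ^ᴿ N) ∤ x)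
  ¬¬-bounded-multiplicity {x} x≉0 k = ¬¬-excluded-middle {A = Unit x} λ where
    (yes x-unit) → k (1 , λ p^1∣x → p∤1 (∣ʳ-trans (∣ʳ-respˡ-≈ p^1≈p p^1∣x) x-unit))
    (no ¬x-unit) → let xs , irr-xs , x≈xs = factorise x x≉0 ¬x-unit in
      k (suc (length xs) , λ (q , qp^N≈x) →
        ¬¬-long-factorisation (length xs) (λ q≈0 → x≉0 (trans (sym qp^N≈x) (trans (*-congʳ q≈0) (zeroˡ _))))
          λ (ys , irr-ys , qp^N≈ys , longer) →
            ℕP.<-irrefl (factorisation-length-unique irr-xs irr-ys (trans (sym x≈xs) (trans (sym qp^N≈x) qp^N≈ys)))
                        longer)

  ¬¬-IsVal : ∀ {x} → x ≉ᴿ 0ᴿ → DoubleNegation (∃ (IsVal p x))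
  ¬¬-IsVal {x} x≉0 ¬val = ¬¬-bounded-multiplicity x≉0 λ (N , p^N∤x) → ¬¬-p^∣ N p^N∤x
    where
      ¬¬-p^∣ : ∀ M → DoubleNegation ((p ^ᴿ M) ∣ x)
      ¬¬-p^∣ zero    k = k (1∣ x)
      ¬¬-p^∣ (suc M) k = ¬¬-p^∣ M λ p^M∣x → ¬¬-excluded-middle {A = (p ^ᴿ suc M) ∣ x} λ where
        (yes p^1+M∣x) → k p^1+M∣x
        (no p^1+M∤x)  → ¬val (M , p^M∣x , p^1+M∤x)

module DirichletProducts {c ℓ} (R : CommutativeRing c ℓ) where
  open RingLemmas R

  sumᴿ : ℕ → (ℕ → Carrier) → Carrier
  sumᴿ zero    f = f zero
  sumᴿ (suc i) f = sumᴿ i f ⊕ f (suc i)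

  ∣-sumᴿ : ∀ {d} i f → (∀ j → j ≤ i → d ∣ f j) → d ∣ sumᴿ i f
  ∣-sumᴿ zero    f d∣f = d∣f zero z≤n
  ∣-sumᴿ (suc i) f d∣f = ∣-+ (∣-sumᴿ i f λ j j≤i → d∣f j (ℕP.m≤n⇒m≤1+n j≤i)) (d∣f (suc i) ℕP.≤-refl)

  sumᴿ-isolate : ∀ {d} i f {j₀} → j₀ ≤ i → (∀ j → j ≤ i → j ≢ j₀ → d ∣ f j) →
                 ∃ λ r → sumᴿ i f ≈ᴿ (f j₀ ⊕ r) × d ∣ r
  sumᴿ-isolate zero    f z≤n _ = 0ᴿ , sym (+-identityʳ _) , (_ ∣0)
  sumᴿ-isolate (suc i) f j₀≤1+i d∣f with ℕP.m≤n⇒m<n∨m≡n j₀≤1+i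
  ... | inj₂ ≡.refl = sumᴿ i f , +-comm _ _ ,
                      ∣-sumᴿ i f λ j j≤i → d∣f j (ℕP.m≤n⇒m≤1+n j≤i) λ { ≡.refl → ℕP.<-irrefl ≡.refl (s≤s j≤i) }
  ... | inj₁ (s≤s j₀≤i) with sumᴿ-isolate i f j₀≤i (λ j j≤i → d∣f j (ℕP.m≤n⇒m≤1+n j≤i))
  ...   | r , sum≈ , d∣r = r ⊕ f (suc i) ,
                           trans (+-cong sum≈ refl) (+-assoc _ _ _) ,
                           ∣-+ d∣r (d∣f (suc i) ℕP.≤-refl λ { ≡.refl → ℕP.<-irrefl ≡.refl (s≤s j₀≤i) })

  -- All that the argument needs to know about a Dirichlet product H = X ⋆ Y.
  IsDirichletProduct : (X Y H : ℕ → Carrier) → Set _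
  IsDirichletProduct X Y H = ∀ {d} i j₀ k₀ → 1 ≤ i → j₀ * k₀ ≡ i →
    (∀ j k → j * k ≡ i → ¬ (j ≡ j₀ × k ≡ k₀) → d ∣ (X j · Y k)) →
    ∃ λ r → H i ≈ᴿ ((X j₀ · Y k₀) ⊕ r) × d ∣ r

  IsDirichletProduct-comm : ∀ {X Y H} → IsDirichletProduct X Y H → IsDirichletProduct Y X H
  IsDirichletProduct-comm {X} {Y} XY=H i j₀ k₀ 1≤i j₀k₀=i d∣others
    with XY=H i k₀ j₀ 1≤i (≡.trans (ℕP.*-comm k₀ j₀) j₀k₀=i)
              (λ j k jk=i ≢ → ∣ʳ-respʳ-≈ (*-comm (Y k) (X j))
                                (d∣others k j (≡.trans (ℕP.*-comm k j) jk=i) λ (k≡ , j≡) → ≢ (j≡ , k≡)))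
  ... | r , H≈ , d∣r = r , trans H≈ (+-cong (*-comm (X k₀) (Y j₀)) refl) , d∣r

  IsDirichletProduct-∣ : ∀ {X Y H d} → IsDirichletProduct X Y H → ∀ i → 1 ≤ i →
                         (∀ j k → j * k ≡ i → d ∣ (X j · Y k)) → d ∣ H i
  IsDirichletProduct-∣ XY=H i 1≤i d∣terms with XY=H i i 1 1≤i (ℕP.*-identityʳ i) (λ j k jk=i _ → d∣terms j k jk=i)
  ... | r , H≈ , d∣r = ∣ʳ-respʳ-≈ (sym H≈) (∣-+ (d∣terms i 1 (ℕP.*-identityʳ i)) d∣r)

  ⊛-term : (X Y : ℕ → Carrier) (i j k : ℕ) → Carrier
  ⊛-term X Y i j k = if does (j * k ≟ i) then X j · Y k else 0ᴿ

  private
    ⊛-term-≡ : ∀ X Y {i j k} → j * k ≡ i → ⊛-term X Y i j k ≈ᴿ (X j · Y k)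
    ⊛-term-≡ X Y {i} {j} {k} jk=i =
      reflexive (≡.cong (if_then X j · Y k else 0ᴿ) (dec-true (j * k ≟ i) jk=i))

    ⊛-term-≢ : ∀ X Y {i j k} → j * k ≢ i → ⊛-term X Y i j k ≈ᴿ 0ᴿ
    ⊛-term-≢ X Y {i} {j} {k} jk≠i =
      reflexive (≡.cong (if_then X j · Y k else 0ᴿ) (dec-false (j * k ≟ i) jk≠i))

  infixl 7 _⊛_
  _⊛_ : (ℕ → Carrier) → (ℕ → Carrier) → ℕ → Carrier
  (X ⊛ Y) i = sumᴿ i λ j → sumᴿ i (⊛-term X Y i j)

  ⊛-isDirichletProduct : ∀ X Y → IsDirichletProduct X Y (X ⊛ Y)
  ⊛-isDirichletProduct X Y {d} i j₀ k₀ 1≤i j₀k₀=i d∣others =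
    let r₁ , sum≈ , d∣r₁ = sumᴿ-isolate i row j₀≤i λ j _ j≢j₀ → ∣-sumᴿ i (⊛-term X Y i j) λ k _ →
                             term-∣ j k λ jk=i → d∣others j k jk=i λ (j≡ , _) → j≢j₀ j≡
        r₂ , row≈ , d∣r₂ = sumᴿ-isolate i (⊛-term X Y i j₀) k₀≤i λ k _ k≢k₀ →
                             term-∣ j₀ k λ j₀k=i → d∣others j₀ k j₀k=i λ (_ , k≡) → k≢k₀ k≡
    in r₂ ⊕ r₁ ,
       (begin
         sumᴿ i row                              ≈⟨ sum≈ ⟩
         row j₀ ⊕ r₁                             ≈⟨ +-cong row≈ refl ⟩
         (⊛-term X Y i j₀ k₀ ⊕ r₂) ⊕ r₁            ≈⟨ +-assoc _ r₂ r₁ ⟩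
         ⊛-term X Y i j₀ k₀ ⊕ (r₂ ⊕ r₁)            ≈⟨ +-cong term-j₀k₀ refl ⟩
         (X j₀ · Y k₀) ⊕ (r₂ ⊕ r₁)               ∎) ,
       ∣-+ d∣r₂ d∣r₁
    where
      row : ℕ → Carrier
      row j = sumᴿ i (⊛-term X Y i j)
      j₀≤i : j₀ ≤ i
      j₀≤i = ≡.subst (j₀ ≤_) j₀k₀=i (1≤m*n⇒m≤m*n j₀ k₀ (≡.subst (1 ≤_) (≡.sym j₀k₀=i) 1≤i))
      k₀≤i : k₀ ≤ i
      k₀≤i = ≡.subst (k₀ ≤_) j₀k₀=i (1≤m*n⇒n≤m*n j₀ k₀ (≡.subst (1 ≤_) (≡.sym j₀k₀=i) 1≤i))
      term-∣ : ∀ j k → (j * k ≡ i → d ∣ (X j · Y k)) → d ∣ ⊛-term X Y i j k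
      term-∣ j k d∣ with j * k ≟ i
      ... | yes jk=i = ∣ʳ-respʳ-≈ (sym (⊛-term-≡ X Y jk=i)) (d∣ jk=i)
      ... | no jk≠i  = ∣ʳ-respʳ-≈ (sym (⊛-term-≢ X Y jk≠i)) (_ ∣0)
      term-j₀k₀ : ⊛-term X Y i j₀ k₀ ≈ᴿ (X j₀ · Y k₀)
      term-j₀k₀ = ⊛-term-≡ X Y j₀k₀=i

module ClearingDenominators {c ℓ} (R : CommutativeRing c ℓ) (domain : RingDefs.IsIntegralDomain R) where
  open IntegralDomainLemmas R domain
  open DirichletProducts R

  sumQ-common : ∀ {D} i (f : ℕ → Frac) (g : ℕ → Carrier) →
                (∀ j → j ≤ i → f j ≈Q (g j , D)) → sumQ i f ≈Q (sumᴿ i g , D)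
  sumQ-common zero    f g f≈g = f≈g zero z≤n
  sumQ-common {D} (suc i) f g f≈g = begin
    (num · b ⊕ a · den) · D           ≈⟨ distribʳ D _ _ ⟩
    (num · b) · D ⊕ (a · den) · D     ≈⟨ +-cong (xy∙z≈xz∙y num b D) (xy∙z≈xz∙y a den D) ⟩
    (num · D) · b ⊕ (a · D) · den     ≈⟨ +-cong (*-congʳ (sumQ-common i f g λ j j≤i → f≈g j (ℕP.m≤n⇒m≤1+n j≤i)))
                                                (*-congʳ (f≈g (suc i) ℕP.≤-refl)) ⟩
    (S · den) · b ⊕ (g′ · b) · den    ≈⟨ +-cong (*-assoc S den b) (trans (*-assoc g′ b den) (*-congˡ (*-comm b den))) ⟩
    S · (den · b) ⊕ g′ · (den · b)    ≈⟨ distribʳ _ S g′ ⟨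
    (S ⊕ g′) · (den · b)              ∎
    where
      num den a b S g′ : Carrier
      num = proj₁ (sumQ i f)
      den = proj₂ (sumQ i f)
      a = proj₁ (f (suc i))
      b = proj₂ (f (suc i))
      S = sumᴿ i g
      g′ = g (suc i)

  sumQ-valid : ∀ i (f : ℕ → Frac) → (∀ j → j ≤ i → ValidFrac (f j)) → ValidFrac (sumQ i f)
  sumQ-valid zero    f valid = valid zero z≤n
  sumQ-valid (suc i) f valid = *-≉0 (sumQ-valid i f λ j j≤i → valid j (ℕP.m≤n⇒m≤1+n j≤i)) (valid (suc i) ℕP.≤-refl)

  record OverCommonDenominator (F : ℕ → Frac) : Set (c ⊔ ℓ) where
    field
      den   : Carrier
      den≉0 : den ≉ᴿ 0ᴿ
      num   : ℕ → Carrier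
      F≈    : ∀ j → F j ≈Q (num j , den)

  private
    common-denominator-≤ : ∀ {F : ℕ → Frac} → (∀ i → ValidFrac (F i)) → ∀ N →
      Σ Carrier λ D → D ≉ᴿ 0ᴿ × Σ (ℕ → Carrier) λ F′ → ∀ j → j ≤ N → F j ≈Q (F′ j , D)
    common-denominator-≤ {F} valid zero = proj₂ (F 0) , valid 0 , (λ _ → proj₁ (F 0)) , λ { .zero z≤n → refl }
    common-denominator-≤ {F} valid (suc N) with common-denominator-≤ valid N
    ... | D , D≉0 , F′ , F≈ = D · b , *-≉0 D≉0 (valid (suc N)) , F″ , F≈″
      where
        b : Carrier
        b = proj₂ (F (suc N))
        F″ : ℕ → Carrier
        F″ j with j ≤? N
        ... | yes _ = F′ j · b
        ... | no _  = proj₁ (F (suc N)) · D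
        F≈″ : ∀ j → j ≤ suc N → F j ≈Q (F″ j , D · b)
        F≈″ j j≤1+N with j ≤? N
        ... | yes j≤N = trans (sym (*-assoc _ D b)) (trans (*-congʳ (F≈ j j≤N)) (xy∙z≈xz∙y (F′ j) _ b))
        ... | no j≰N with ℕP.≤-antisym j≤1+N (ℕP.≰⇒> j≰N)
        ...   | ≡.refl = sym (*-assoc _ D b)

  ≈Q0⇒num≈0 : ∀ {x} → x ≈Q 0Q → proj₁ x ≈ᴿ 0ᴿ
  ≈Q0⇒num≈0 {x} x≈0 = trans (sym (*-identityʳ _)) (trans x≈0 (zeroˡ _))

  common-denominator : ∀ {F : ℕ → Frac} → (∀ i → ValidFrac (F i)) → ∀ N → (∀ i → N < i → F i ≈Q 0Q) →
                       OverCommonDenominator F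
  common-denominator {F} valid N F≈0 with common-denominator-≤ valid N
  ... | D , D≉0 , F′ , F≈ = record { den = D ; den≉0 = D≉0 ; num = F″ ; F≈ = F≈″ }
    where
      F″ : ℕ → Carrier
      F″ j with j ≤? N
      ... | yes _ = F′ j
      ... | no _  = 0ᴿ
      F≈″ : ∀ j → F j ≈Q (F″ j , D)
      F≈″ j with j ≤? N
      ... | yes j≤N = F≈ j j≤N
      ... | no j≰N  = begin
        proj₁ (F j) · D   ≈⟨ *-congʳ (≈Q0⇒num≈0 (F≈0 j (ℕP.≰⇒> j≰N))) ⟩
        0ᴿ · D            ≈⟨ zeroˡ D ⟩
        0ᴿ                ≈⟨ zeroˡ _ ⟨
        0ᴿ · proj₂ (F j)  ∎

  module _ {F : ℕ → Frac} (valid : ∀ i → ValidFrac (F i)) (F/D : OverCommonDenominator F) where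
    open OverCommonDenominator F/D

    ≈Q0⇒≈0 : ∀ {j} → F j ≈Q 0Q → num j ≈ᴿ 0ᴿ
    ≈Q0⇒≈0 {j} Fj≈0 with proj₂ domain (num j) (proj₂ (F j))
                           (trans (sym (F≈ j)) (trans (*-congʳ (≈Q0⇒num≈0 Fj≈0)) (zeroˡ den)))
    ... | inj₁ num≈0 = num≈0
    ... | inj₂ den≈0 = contradiction den≈0 (valid j)

    ≈0⇒≈Q0 : ∀ {j} → num j ≈ᴿ 0ᴿ → F j ≈Q 0Q
    ≈0⇒≈Q0 {j} num≈0 with proj₂ domain (proj₁ (F j)) den (trans (F≈ j) (trans (*-congʳ num≈0) (zeroˡ _)))
    ... | inj₁ Fn≈0 = trans (*-identityʳ _) (trans Fn≈0 (sym (zeroˡ _)))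
    ... | inj₂ den≈0 = contradiction den≈0 den≉0

  module _ {F G : ℕ → Frac} (F-valid : ∀ i → ValidFrac (F i)) (G-valid : ∀ i → ValidFrac (G i))
           (F/D : OverCommonDenominator F) (G/E : OverCommonDenominator G) where
    open OverCommonDenominator F/D renaming (den to D; num to F′; F≈ to F≈)
    open OverCommonDenominator G/E renaming (den to E; num to G′; F≈ to G≈)

    private
      T : ℕ → ℕ → ℕ → Frac
      T i j k = if does (j * k ≟ i) then F j *Q G k else 0Q

      T≈ : ∀ i j k → T i j k ≈Q (⊛-term F′ G′ i j k , D · E)
      T≈ i j k with does (j * k ≟ i)
      ... | true  = begin
        (proj₁ (F j) · proj₁ (G k)) · (D · E)       ≈⟨ interchange _ _ D E ⟩
        (proj₁ (F j) · D) · (proj₁ (G k) · E)       ≈⟨ *-cong (F≈ j) (G≈ k) ⟩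
        (F′ j · proj₂ (F j)) · (G′ k · proj₂ (G k)) ≈⟨ interchange _ _ _ _ ⟩
        (F′ j · G′ k) · (proj₂ (F j) · proj₂ (G k)) ∎
      ... | false = trans (zeroˡ _) (sym (zeroˡ _))

      T-valid : ∀ i j k → ValidFrac (T i j k)
      T-valid i j k with does (j * k ≟ i)
      ... | true  = *-≉0 (F-valid j) (G-valid k)
      ... | false = 1≉0

    ⋆≈⊛ : ∀ i → (F ⋆ G) i ≈Q ((F′ ⊛ G′) i , D · E)
    ⋆≈⊛ i = sumQ-common i _ _ λ j _ → sumQ-common i (T i j) (⊛-term F′ G′ i j) λ k _ → T≈ i j k

    ⋆-valid : ∀ i → ValidFrac ((F ⋆ G) i)
    ⋆-valid i = sumQ-valid i _ λ j _ → sumQ-valid i (T i j) λ k _ → T-valid i j k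

    ι≈⋆⇒⊛≈ : ∀ {g} i → ι g ≈Q (F ⋆ G) i → (F′ ⊛ G′) i ≈ᴿ ((D · E) · g)
    ι≈⋆⇒⊛≈ {g} i g≈FG = *-cancelˡ-≉0 (⋆-valid i) (begin
      den · (F′ ⊛ G′) i    ≈⟨ *-comm den _ ⟩
      (F′ ⊛ G′) i · den    ≈⟨ ⋆≈⊛ i ⟨
      num · (D · E)        ≈⟨ *-congʳ (trans (sym (*-identityʳ num)) (sym g≈FG)) ⟩
      (g · den) · (D · E)  ≈⟨ trans (*-congʳ (*-comm g den)) (trans (*-assoc den g _) (*-congˡ (*-comm g _))) ⟩
      den · ((D · E) · g)  ∎)
      where
        num den : Carrier
        num = proj₁ ((F ⋆ G) i)
        den = proj₂ ((F ⋆ G) i)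

module Factors {c ℓ} (R : CommutativeRing c ℓ) (ufd : RingDefs.IsUFD R)
               {p : RingDefs.Carrier R} (p-prime : RingDefs.Prime R p) where
  open UFDValuations R ufd p-prime
  open DirichletProducts R
  open ClearingDenominators R (proj₁ ufd)

  -- `decided` can only be supplied under double negation (see ¬¬-decided).
  record Factor : Set (c ⊔ ℓ) where
    field
      coeff       : ℕ → Carrier
      degree      : ℕ
      coeff-0     : coeff 0 ≈ᴿ 0ᴿ
      coeff->     : ∀ j → degree < j → coeff j ≈ᴿ 0ᴿ
      decided     : ∀ j → coeff j ≈ᴿ 0ᴿ ⊎ ∃ (IsVal p (coeff j))
      nonconstant : ∃ λ j → 2 ≤ j × coeff j ≉ᴿ 0ᴿ

    Supp : ℕ → Set ℓ
    Supp j = coeff j ≉ᴿ 0ᴿ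

    Supp? : Decidable Supp
    Supp? j with decided j
    ... | inj₁ coeff≈0     = no λ coeff≉0 → coeff≉0 coeff≈0
    ... | inj₂ (e , val)   = yes (IsVal⇒≉0 {e = e} val)

    -- junk value 0 off the support
    ν : ℕ → ℕ
    ν j with decided j
    ... | inj₁ _         = 0
    ... | inj₂ (e , _)   = e

    Supp⇒IsVal : ∀ {j} → Supp j → IsVal p (coeff j) (ν j)
    Supp⇒IsVal {j} j∈S with decided j
    ... | inj₁ coeff≈0   = contradiction coeff≈0 j∈S
    ... | inj₂ (_ , val) = val

    ¬Supp⇒≈0 : ∀ {j} → ¬ Supp j → coeff j ≈ᴿ 0ᴿ
    ¬Supp⇒≈0 {j} j∉S with decided j
    ... | inj₁ coeff≈0   = coeff≈0
    ... | inj₂ (e , val) = contradiction (IsVal⇒≉0 {e = e} val) j∉S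

    Supp⇒≤degree : ∀ {j} → Supp j → j ≤ degree
    Supp⇒≤degree {j} j∈S with j ≤? degree
    ... | yes j≤degree = j≤degree
    ... | no j≰degree  = contradiction (coeff-> j (ℕP.≰⇒> j≰degree)) j∈S

    Supp⇒1≤ : ∀ {j} → Supp j → 1 ≤ j
    Supp⇒1≤ {zero}  0∈S = contradiction coeff-0 0∈S
    Supp⇒1≤ {suc j} _   = s≤s z≤n

    least-in-Supp : ∀ {_⊑_} → (∀ {x y z} → Supp x → Supp y → Supp z → x ⊑ y → y ⊑ z → x ⊑ z) →
                      (∀ {x y} → Supp x → Supp y → x ⊑ y ⊎ y ⊑ x) → Least Supp _⊑_
    least-in-Supp trans total = least Supp? trans total degree Supp⇒≤degree (proj₂ (proj₂ nonconstant))

    private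
      firstIndex : Least Supp _≤_
      firstIndex = least-in-Supp (λ _ _ _ → ℕP.≤-trans) (λ {x} {y} _ _ → ℕP.≤-total x y)

      lastIndex : Least Supp (flip _≤_)
      lastIndex = least-in-Supp (λ _ _ _ y≤x z≤y → ℕP.≤-trans z≤y y≤x) (λ {x} {y} _ _ → ℕP.≤-total y x)

      lastMinimalIndex : Least Supp (Lex (λ x y → ν x ≤ ν y) (flip _≤_))
      lastMinimalIndex = least-in-Supp
        (Lex-trans {S = Supp} (λ _ _ _ → ℕP.≤-trans) (λ y≤x z≤y → ℕP.≤-trans z≤y y≤x))
        (Lex-total {S = Supp} (λ x y → ν x ≤? ν y) (λ {x} {y} _ _ → ℕP.≤-total (ν x) (ν y)) (λ x y → ℕP.≤-total y x))

    open Least firstIndex public using () renaming (min to first; min∈ to first∈; min-⊑ to first-≤)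
    open Least lastIndex public using () renaming (min to last; min∈ to last∈; min-⊑ to ≤-last)
    open Least lastMinimalIndex public using () renaming (min to lastMinimal; min∈ to lastMinimal∈)

    minν : ℕ
    minν = ν lastMinimal

    minν-≤ : ∀ {j} → Supp j → minν ≤ ν j
    minν-≤ j∈S = proj₁ (Least.min-⊑ lastMinimalIndex j∈S)

    ν≤minν⇒≤lastMinimal : ∀ {j} → Supp j → ν j ≤ minν → j ≤ lastMinimal
    ν≤minν⇒≤lastMinimal j∈S = proj₂ (Least.min-⊑ lastMinimalIndex j∈S)

    minν-< : ∀ {j} → Supp j → lastMinimal < j → minν < ν j
    minν-< {j} j∈S lastMinimal<j with ℕP.m≤n⇒m<n∨m≡n (minν-≤ j∈S)
    ... | inj₁ minν<νj = minν<νj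
    ... | inj₂ minν≡νj = contradiction (ν≤minν⇒≤lastMinimal j∈S (ℕP.≤-reflexive (≡.sym minν≡νj)))
                                       (ℕP.<⇒≱ lastMinimal<j)

    2≤last : 2 ≤ last
    2≤last = ℕP.≤-trans (proj₁ (proj₂ nonconstant)) (≤-last (proj₂ (proj₂ nonconstant)))

  ¬¬-decided : ∀ (f : ℕ → Carrier) N → (∀ j → N < j → f j ≈ᴿ 0ᴿ) →
               DoubleNegation (∀ j → f j ≈ᴿ 0ᴿ ⊎ ∃ (IsVal p (f j)))
  ¬¬-decided f N f≈0 k = ¬¬-∀< ¬¬-zero-or-IsVal (suc N) λ below → k λ j → case j ≤? N of λ where
      (yes j≤N) → below j (s≤s j≤N)
      (no j≰N)  → inj₁ (f≈0 j (ℕP.≰⇒> j≰N))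
    where
      ¬¬-zero-or-IsVal : ∀ j → DoubleNegation (f j ≈ᴿ 0ᴿ ⊎ ∃ (IsVal p (f j)))
      ¬¬-zero-or-IsVal j k′ = ¬¬-excluded-middle {A = f j ≈ᴿ 0ᴿ} λ where
        (yes f≈0) → k′ (inj₁ f≈0)
        (no f≉0)  → ¬¬-IsVal f≉0 λ val → k′ (inj₂ val)

  module _ {F : ℕ → Frac} (F-poly : IsDirPolyQ F) (F/D : OverCommonDenominator F) where
    open OverCommonDenominator F/D

    private
      valid : ∀ i → ValidFrac (F i)
      valid = proj₁ F-poly

      N : ℕ
      N = proj₁ (proj₂ (proj₂ F-poly))

      num-above : ∀ j → N < j → num j ≈ᴿ 0ᴿ
      num-above j N<j = ≈Q0⇒≈0 valid F/D (proj₂ (proj₂ (proj₂ F-poly)) j N<j)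

    polynomialFactor : NonConstantQ F → (∀ j → num j ≈ᴿ 0ᴿ ⊎ ∃ (IsVal p (num j))) → Factor
    polynomialFactor (i , 2≤i , Fi≉0) decided = record
      { coeff = num ; degree = N ; coeff-0 = ≈Q0⇒≈0 valid F/D (proj₁ (proj₂ F-poly))
      ; coeff-> = num-above ; decided = decided
      ; nonconstant = i , 2≤i , λ num≈0 → Fi≉0 (≈0⇒≈Q0 valid F/D num≈0) }

    ¬¬-polynomialFactor : NonConstantQ F → DoubleNegation (Σ Factor λ X → Factor.coeff X ≡ num)
    ¬¬-polynomialFactor nonconstant k = ¬¬-decided num N num-above λ decided →
      k (polynomialFactor nonconstant decided , ≡.refl)

  -- The leftmost vertex of the Newton polygon that supports the line of slope log ρ
  module LeftmostMinimalWeight (X : Factor) {d c : ℕ} (c>0 : 0 < c) (c≤d : c ≤ d) where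
    open Factor X
    open Weights c>0 c≤d

    w : ℕ → ℕ × ℕ
    w j = weight (ν j) j

    w-den>0 : ∀ {j} → Supp j → 0 < proj₂ (w j)
    w-den>0 {j} j∈S = ℕP.*-mono-≤ (c^>0 (ν j)) (Supp⇒1≤ j∈S)

    private
      pivotIndex : Least Supp (Lex (λ x y → w x ≼ w y) _≤_)
      pivotIndex = least-in-Supp
        (Lex-trans {S = Supp} (λ {x} {y} {z} _ y∈S _ → ≼-trans {w x} {w y} {w z} (w-den>0 y∈S)) ℕP.≤-trans)
        (Lex-total {S = Supp} (λ x y → w x ≼? w y) (λ {x} {y} _ _ → ≼-total (w x) (w y)) ℕP.≤-total)

    open Least pivotIndex public using () renaming (min to pivot; min∈ to pivot∈)

    pivot-min : ∀ {j} → Supp j → w pivot ≼ w j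
    pivot-min j∈S = proj₁ (Least.min-⊑ pivotIndex j∈S)

    pivot-leftmost : ∀ {j} → Supp j → w j ≼ w pivot → pivot ≤ j
    pivot-leftmost j∈S = proj₂ (Least.min-⊑ pivotIndex j∈S)

  module FactorPair (X Y : Factor) {H : ℕ → Carrier}
                    (X⋆Y=H : IsDirichletProduct (Factor.coeff X) (Factor.coeff Y) H) where
    module X = Factor X
    module Y = Factor Y

    term≈0 : ∀ {j k} → ¬ (X.Supp j × Y.Supp k) → (X.coeff j · Y.coeff k) ≈ᴿ 0ᴿ
    term≈0 {j} {k} ¬both with X.Supp? j | Y.Supp? k
    ... | yes j∈X | yes k∈Y = contradiction (j∈X , k∈Y) ¬both
    ... | no j∉X  | _       = trans (*-congʳ (X.¬Supp⇒≈0 j∉X)) (zeroˡ _)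
    ... | yes _   | no k∉Y  = trans (*-congˡ (Y.¬Supp⇒≈0 k∉Y)) (zeroʳ _)

    p^∣term : ∀ M {j k} → (X.Supp j → Y.Supp k → M ≤ X.ν j + Y.ν k) → (p ^ᴿ M) ∣ (X.coeff j · Y.coeff k)
    p^∣term M {j} {k} M≤ with X.Supp? j | Y.Supp? k
    ... | yes j∈X | yes k∈Y = IsVal⇒∣ (IsVal-* {a = X.ν j} (X.Supp⇒IsVal j∈X) (Y.Supp⇒IsVal k∈Y)) (M≤ j∈X k∈Y)
    ... | no j∉X  | _       = ∣ʳ-respʳ-≈ (sym (term≈0 λ (j∈X , _) → j∉X j∈X)) (_ ∣0)
    ... | yes _   | no k∉Y  = ∣ʳ-respʳ-≈ (sym (term≈0 λ (_ , k∈Y) → k∉Y k∈Y)) (_ ∣0)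

    H≈0 : ∀ {i} → 1 ≤ i → (∀ {j k} → j * k ≡ i → ¬ (X.Supp j × Y.Supp k)) → H i ≈ᴿ 0ᴿ
    H≈0 {i} 1≤i no-pair = 0∣x⇒x≈0 (IsDirichletProduct-∣ X⋆Y=H i 1≤i λ j k jk=i →
                            ∣ʳ-respʳ-≈ (sym (term≈0 (no-pair jk=i))) ∣ʳ-refl)

    IsVal-H : ∀ {i j₀ k₀} → 1 ≤ i → j₀ * k₀ ≡ i → X.Supp j₀ → Y.Supp k₀ →
              (∀ {j k} → j * k ≡ i → ¬ (j ≡ j₀ × k ≡ k₀) → X.Supp j → Y.Supp k →
                 X.ν j₀ + Y.ν k₀ < X.ν j + Y.ν k) →
              IsVal p (H i) (X.ν j₀ + Y.ν k₀)
    IsVal-H {i} {j₀} {k₀} 1≤i j₀k₀=i j₀∈X k₀∈Y others-larger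
      with X⋆Y=H i j₀ k₀ 1≤i j₀k₀=i (λ j k jk=i ≢ → p^∣term _ (others-larger jk=i ≢))
    ... | r , H≈ , p∣r = IsVal-resp {e = X.ν j₀ + Y.ν k₀} (sym H≈)
                           (IsVal-+ {e = X.ν j₀ + Y.ν k₀} (IsVal-* {a = X.ν j₀} (X.Supp⇒IsVal j₀∈X) (Y.Supp⇒IsVal k₀∈Y)) p∣r)

    p^minν∣H : ∀ i → 1 ≤ i → (p ^ᴿ (X.minν + Y.minν)) ∣ H i
    p^minν∣H i 1≤i = IsDirichletProduct-∣ X⋆Y=H i 1≤i λ j k _ →
                       p^∣term _ λ j∈X k∈Y → ℕP.+-mono-≤ (X.minν-≤ j∈X) (Y.minν-≤ k∈Y)

    1≤first*first : 1 ≤ X.first * Y.first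
    1≤first*first = ℕP.*-mono-≤ (X.Supp⇒1≤ X.first∈) (Y.Supp⇒1≤ Y.first∈)

    1≤last*last : 1 ≤ X.last * Y.last
    1≤last*last = ℕP.*-mono-≤ (X.Supp⇒1≤ X.last∈) (Y.Supp⇒1≤ Y.last∈)

    IsVal-H-first : IsVal p (H (X.first * Y.first)) (X.ν X.first + Y.ν Y.first)
    IsVal-H-first = IsVal-H 1≤first*first ≡.refl X.first∈ Y.first∈ λ {j} {k} jk=ff ≢ j∈X k∈Y →
      contradiction (*-≤-tight (X.first-≤ j∈X) (Y.first-≤ k∈Y) jk=ff (X.Supp⇒1≤ X.first∈) (Y.Supp⇒1≤ Y.first∈)) ≢

    IsVal-H-last : IsVal p (H (X.last * Y.last)) (X.ν X.last + Y.ν Y.last)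
    IsVal-H-last = IsVal-H 1≤last*last ≡.refl X.last∈ Y.last∈ λ {j} {k} jk=ll ≢ j∈X k∈Y →
      contradiction (*-≤-tight (X.≤-last j∈X) (Y.≤-last k∈Y) (≡.sym jk=ll) (X.Supp⇒1≤ j∈X) (Y.Supp⇒1≤ k∈Y))
                    λ (l≡j , l≡k) → ≢ (≡.sym l≡j , ≡.sym l≡k)

    IsVal-H-lastMinimal : IsVal p (H (X.lastMinimal * Y.lastMinimal)) (X.minν + Y.minν)
    IsVal-H-lastMinimal = IsVal-H (ℕP.*-mono-≤ (X.Supp⇒1≤ X.lastMinimal∈) (Y.Supp⇒1≤ Y.lastMinimal∈))
      ≡.refl X.lastMinimal∈ Y.lastMinimal∈ λ {j} {k} jk=mm ≢ j∈X k∈Y →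
      case *-≡⇒<⊎< (≡.sym jk=mm) (X.Supp⇒1≤ j∈X) (Y.Supp⇒1≤ k∈Y) (λ (m≡j , m≡k) → ≢ (≡.sym m≡j , ≡.sym m≡k)) of λ where
        (inj₁ mX<j) → ℕP.+-mono-<-≤ (X.minν-< j∈X mX<j) (Y.minν-≤ k∈Y)
        (inj₂ mY<k) → ℕP.+-mono-≤-< (X.minν-≤ j∈X) (Y.minν-< k∈Y mY<k)

    H≈0-below-first : ∀ {i} → 1 ≤ i → i < X.first * Y.first → H i ≈ᴿ 0ᴿ
    H≈0-below-first 1≤i i<ff = H≈0 1≤i λ jk=i (j∈X , k∈Y) →
      ℕP.<⇒≱ i<ff (≡.subst (_ ≤_) jk=i (ℕP.*-mono-≤ (X.first-≤ j∈X) (Y.first-≤ k∈Y)))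

    H≈0-above-last : ∀ {i} → X.last * Y.last < i → H i ≈ᴿ 0ᴿ
    H≈0-above-last ll<i = H≈0 (ℕP.≤-<-trans z≤n ll<i) λ jk=i (j∈X , k∈Y) →
      ℕP.<⇒≱ ll<i (≡.subst (_≤ _) jk=i (ℕP.*-mono-≤ (X.≤-last j∈X) (Y.≤-last k∈Y)))

    monomial∣ : X.first ≡ X.last → ∀ {i} → 1 ≤ i → H i ≉ᴿ 0ᴿ → X.first ℕD.∣ i
    monomial∣ first≡last {i} 1≤i H≉0 = decidable-stable (X.first ℕD.∣? i) λ first∤i →
      H≉0 (H≈0 1≤i λ {j} {k} jk=i (j∈X , _) → first∤i (ℕD.divides k (≡.trans (≡.sym jk=i) (≡.trans (ℕP.*-comm j k)
        (≡.cong (k *_) (ℕP.≤-antisym (≡.subst (j ≤_) (≡.sym first≡last) (X.≤-last j∈X)) (X.first-≤ j∈X)))))))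

    module Slopes {d c : ℕ} (c>0 : 0 < c) (c≤d : c ≤ d) where
      open Weights c>0 c≤d
      module PX = LeftmostMinimalWeight X c>0 c≤d
      module PY = LeftmostMinimalWeight Y c>0 c≤d
      open PX using (pivot; pivot∈)
      open PY using () renaming (pivot to pivotʸ; pivot∈ to pivotʸ∈)

      private
        A₀ : ℕ
        A₀ = X.ν pivot + Y.ν pivotʸ

        weights-⊗ : ∀ {j k i} → j * k ≡ i → PX.w j ⊗ PY.w k ≡ weight (X.ν j + Y.ν k) i
        weights-⊗ {j} {k} jk=i = ≡.trans (weight-⊗ (X.ν j) j (Y.ν k) k) (≡.cong (weight (X.ν j + Y.ν k)) jk=i)

        ≺⇒< : ∀ {j k} → j * k ≡ pivot * pivotʸ → ¬ PX.w j ⊗ PY.w k ≼ PX.w pivot ⊗ PY.w pivotʸ →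
              A₀ < X.ν j + Y.ν k
        ≺⇒< jk=i ≺ = ℕP.≰⇒> λ A≤A₀ →
          ≺ (≡.subst₂ _≼_ (≡.sym (weights-⊗ jk=i)) (≡.sym (weights-⊗ ≡.refl)) (weight-monoˡ-≼ (pivot * pivotʸ) A≤A₀))

      IsVal-H-pivots : IsVal p (H (pivot * pivotʸ)) A₀
      IsVal-H-pivots = IsVal-H (ℕP.*-mono-≤ (X.Supp⇒1≤ pivot∈) (Y.Supp⇒1≤ pivotʸ∈)) ≡.refl pivot∈ pivotʸ∈
        λ {j} {k} jk=i ≢ j∈X k∈Y → ≺⇒< jk=i (case *-≡⇒<⊎< jk=i (X.Supp⇒1≤ pivot∈) (Y.Supp⇒1≤ pivotʸ∈) ≢ of λ where
          (inj₁ j<pivot)  → ⊗-mono-≺-≼ {PX.w pivot} {PX.w j} {PY.w pivotʸ} {PY.w k} (λ wj≼ → ℕP.<⇒≱ j<pivot (PX.pivot-leftmost j∈X wj≼)) (PY.pivot-min k∈Y)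
                                        (d^>0 (Y.ν k)) (PY.w-den>0 pivotʸ∈)
          (inj₂ k<pivotʸ) → ⊗-mono-≼-≺ {PX.w pivot} {PX.w j} {PY.w pivotʸ} {PY.w k} (PX.pivot-min j∈X) (λ wk≼ → ℕP.<⇒≱ k<pivotʸ (PY.pivot-leftmost k∈Y wk≼))
                                        (d^>0 (X.ν j)) (PX.w-den>0 pivot∈))

      pivots-≼-lasts : weight A₀ (pivot * pivotʸ) ≼ weight (X.ν X.last + Y.ν Y.last) (X.last * Y.last)
      pivots-≼-lasts = ≡.subst₂ _≼_ (weights-⊗ ≡.refl) (weights-⊗ ≡.refl)
                         (⊗-mono-≼ {PX.w pivot} {PX.w X.last} {PY.w pivotʸ} {PY.w Y.last} (PX.pivot-min X.last∈) (PY.pivot-min Y.last∈))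

module Irreducibility {c ℓ} (R : CommutativeRing c ℓ) (ufd : RingDefs.IsUFD R)
                      {p : RingDefs.Carrier R} (p-prime : RingDefs.Prime R p) where
  open UFDValuations R ufd p-prime
  open Factors R ufd p-prime
  open DirichletProducts R

  module _ {m n : ℕ} (1≤m : 1 ≤ m) (m<n : m < n) {a : ℕ → Carrier}
           (a-below : ∀ j → j < m → a j ≈ᴿ 0ᴿ) (a-above : ∀ j → n < j → a j ≈ᴿ 0ᴿ)
           (a-m≉0 : a m ≉ᴿ 0ᴿ) (a-n≉0 : a n ≉ᴿ 0ᴿ) (a-primitive : AlgPrimitive m n a)
           {dδ cδ : ℕ} (δ : IsDelta m n dδ cδ) {dρ cρ : ℕ} (ρ : IsRho m n dρ cρ)
           {k : ℕ} (p∤a-k : p ∤ a k)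
           (p∣a-large : ∀ j → m * dδ ≤ j * cδ → p ∣ a j)
           (ρ-bound : ∀ i eᵢ eₙ → i < n → IsVal p (a i) eᵢ → IsVal p (a n) eₙ → eᵢ < eₙ →
                        (dρ ^ (eₙ ∸ eᵢ)) * i < n * (cρ ^ (eₙ ∸ eᵢ)))
           {b : ℕ → Carrier} (b≉0 : ∀ j → m ≤ j → j ≤ n → b j ≉ᴿ 0ᴿ) (p∤b-kb-n : p ∤ (b k · b n)) where

    g : ℕ → Carrier
    g j = a j · b j

    a≉0⇒m≤ : ∀ {i} → a i ≉ᴿ 0ᴿ → m ≤ i
    a≉0⇒m≤ {i} a≉0 with m ≤? i
    ... | yes m≤i = m≤i
    ... | no m≰i  = contradiction (a-below i (ℕP.≰⇒> m≰i)) a≉0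

    a≉0⇒≤n : ∀ {i} → a i ≉ᴿ 0ᴿ → i ≤ n
    a≉0⇒≤n {i} a≉0 with i ≤? n
    ... | yes i≤n = i≤n
    ... | no i≰n  = contradiction (a-above i (ℕP.≰⇒> i≰n)) a≉0

    a≉0⇒g≉0 : ∀ {i} → a i ≉ᴿ 0ᴿ → g i ≉ᴿ 0ᴿ
    a≉0⇒g≉0 a≉0 = *-≉0 a≉0 (b≉0 _ (a≉0⇒m≤ a≉0) (a≉0⇒≤n a≉0))

    g≉0⇒a≉0 : ∀ {i} → g i ≉ᴿ 0ᴿ → a i ≉ᴿ 0ᴿ
    g≉0⇒a≉0 g≉0 a≈0 = g≉0 (trans (*-congʳ a≈0) (zeroˡ _))

    1≤k : 1 ≤ k
    1≤k = ℕP.≤-trans 1≤m (a≉0⇒m≤ λ a≈0 → p∤a-k (∣ʳ-respʳ-≈ (sym a≈0) (_ ∣0)))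

    p∤b-n : p ∤ b n
    p∤b-n p∣b-n = p∤b-kb-n (x∣ʳy⇒x∣ʳzy (b k) p∣b-n)

    IsVal-g-k : IsVal p (g k) 0
    IsVal-g-k = ∤⇒IsVal-0 (∤-* p∤a-k λ p∣b-k → p∤b-kb-n (∣ʳ-respʳ-≈ (*-comm (b n) (b k)) (x∣ʳy⇒x∣ʳzy (b n) p∣b-k)))

    cρ>0 : 0 < cρ
    cρ>0 = proj₁ (proj₂ (proj₂ ρ))

    cρ≤dρ : cρ ≤ dρ
    cρ≤dρ = ≡.subst₂ _≤_ (ℕP.*-identityˡ cρ) (ℕP.*-identityʳ dρ)
              (proj₂ (proj₂ (proj₂ (proj₂ ρ))) 1 1 (ℕD.1∣ n) (ℕD.1∣ m) (s≤s z≤n) (ℕP.*-monoʳ-≤ 1 (ℕP.<⇒≤ m<n)))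

    IsVal-g-n : ∀ {e} → IsVal p (a n) e → IsVal p (g n) e
    IsVal-g-n {e} val = ≡.subst (IsVal p (g n)) (ℕP.+-identityʳ e) (IsVal-* {a = e} val (∤⇒IsVal-0 p∤b-n))

    module Factorisation {C : Carrier} (C≉0 : C ≉ᴿ 0ᴿ) (X Y : Factor) {H : ℕ → Carrier}
                (X⋆Y=H : IsDirichletProduct (Factor.coeff X) (Factor.coeff Y) H)
                (H≈Cg : ∀ i → 1 ≤ i → H i ≈ᴿ (C · g i)) where
      open FactorPair X Y X⋆Y=H

      H≉0⇒a≉0 : ∀ {i} → 1 ≤ i → H i ≉ᴿ 0ᴿ → a i ≉ᴿ 0ᴿ
      H≉0⇒a≉0 1≤i H≉0 = g≉0⇒a≉0 λ g≈0 → H≉0 (trans (H≈Cg _ 1≤i) (trans (*-congˡ g≈0) (zeroʳ C)))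

      a≉0⇒H≉0 : ∀ {i} → a i ≉ᴿ 0ᴿ → H i ≉ᴿ 0ᴿ
      a≉0⇒H≉0 a≉0 H≈0 = *-≉0 C≉0 (a≉0⇒g≉0 a≉0) (trans (sym (H≈Cg _ (ℕP.≤-trans 1≤m (a≉0⇒m≤ a≉0)))) H≈0)

      IsVal-Cg : ∀ {i κ x} → 1 ≤ i → IsVal p C κ → IsVal p (g i) x → IsVal p (H i) (κ + x)
      IsVal-Cg {κ = κ} 1≤i vC vg = IsVal-resp {e = κ + _} (sym (H≈Cg _ 1≤i)) (IsVal-* {a = κ} vC vg)

      first*first≡m : X.first * Y.first ≡ m
      first*first≡m = ℕP.≤-antisym
        (ℕP.≮⇒≥ λ m<ff → a≉0⇒H≉0 a-m≉0 (H≈0-below-first 1≤m m<ff))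
        (a≉0⇒m≤ (H≉0⇒a≉0 1≤first*first (IsVal⇒≉0 {e = X.ν X.first + Y.ν Y.first} IsVal-H-first)))

      last*last≡n : X.last * Y.last ≡ n
      last*last≡n = ℕP.≤-antisym
        (a≉0⇒≤n (H≉0⇒a≉0 1≤last*last (IsVal⇒≉0 {e = X.ν X.last + Y.ν Y.last} IsVal-H-last)))
        (ℕP.≮⇒≥ λ ll<n → a≉0⇒H≉0 a-n≉0 (H≈0-above-last ll<n))

      -- p ^ (minν X + minν Y) divides H k, whose valuation is that of C, and it is the exact power
      -- of p in H at this index; so p ∤ g there.
      lastMinimal-small : X.lastMinimal * Y.lastMinimal * cδ < m * dδ
      lastMinimal-small = decidable-stable (_ <? _) λ ≮ →
        ¬¬-IsVal C≉0 λ (κ , vC) → ¬¬-IsVal g*≉0 λ (x , vg) →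
          let minν≤κ+0 : X.minν + Y.minν ≤ κ + 0
              minν≤κ+0 = IsVal-≤ {e = κ + 0} (IsVal-Cg {κ = κ} {x = 0} 1≤k vC IsVal-g-k) (p^minν∣H k 1≤k)
              minν≡κ+x : X.minν + Y.minν ≡ κ + x
              minν≡κ+x = IsVal-unique {e = X.minν + Y.minν} IsVal-H-lastMinimal (IsVal-Cg {κ = κ} {x = x} 1≤i* vC vg)
              x≡0 : x ≡ 0
              x≡0 = ℕP.n≤0⇒n≡0 (ℕP.+-cancelˡ-≤ κ x 0 (≡.subst (_≤ κ + 0) minν≡κ+x minν≤κ+0))
          in IsVal-0⇒∤ (≡.subst (IsVal p (g i*)) x≡0 vg) (∣ʳ-trans (p∣a-large i* (ℕP.≮⇒≥ ≮)) (x∣xy (a i*) (b i*)))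
        where
          i* : ℕ
          i* = X.lastMinimal * Y.lastMinimal
          1≤i* : 1 ≤ i*
          1≤i* = ℕP.*-mono-≤ (X.Supp⇒1≤ X.lastMinimal∈) (Y.Supp⇒1≤ Y.lastMinimal∈)
          g*≉0 : g i* ≉ᴿ 0ᴿ
          g*≉0 = a≉0⇒g≉0 (H≉0⇒a≉0 1≤i* (IsVal⇒≉0 {e = X.minν + Y.minν} IsVal-H-lastMinimal))

      last∣n : X.last ℕD.∣ n
      last∣n = ℕD.divides Y.last (≡.trans (≡.sym last*last≡n) (ℕP.*-comm X.last Y.last))

      first∣m : X.first ℕD.∣ m
      first∣m = ℕD.divides Y.first (≡.trans (≡.sym first*first≡m) (ℕP.*-comm X.first Y.first))

      minν<ν-last : X.minν < X.ν X.last
      minν<ν-last with ℕP.m≤n⇒m<n∨m≡n (X.minν-≤ X.last∈)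
      ... | inj₁ minν<ν-last = minν<ν-last
      ... | inj₂ minν≡ν-last with ℕP.m≤n⇒m<n∨m≡n (X.first-≤ X.last∈)
      ...   | inj₁ first<last = ⊥-elim (ℕP.<⇒≱ lastMinimal-small (≡.subst (λ l → m * dδ ≤ l * Y.lastMinimal * cδ) last≡lastMinimal
                                  (δ-bound {u = X.first} {v = Y.first} {U = X.last} {V = Y.lastMinimal} first*first≡m δ-step (Y.first-≤ Y.lastMinimal∈))))
        where
          last≡lastMinimal : X.last ≡ X.lastMinimal
          last≡lastMinimal = ℕP.≤-antisym (X.ν≤minν⇒≤lastMinimal X.last∈ (ℕP.≤-reflexive (≡.sym minν≡ν-last)))
                                          (X.≤-last X.lastMinimal∈)
          δ-step : dδ * X.first ≤ X.last * cδ
          δ-step = proj₂ (proj₂ (proj₂ (proj₂ δ))) X.last X.first last∣n first∣m (X.Supp⇒1≤ X.first∈) first<last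
      ...   | inj₂ first≡last = ⊥-elim (ℕP.<⇒≢ X.2≤last
                                 (≡.trans (≡.sym (a-primitive X.first λ j m≤j _ a≉0 →
                                   monomial∣ first≡last (ℕP.≤-trans 1≤m m≤j) (a≉0⇒H≉0 a≉0))) first≡last))

      module NewtonPolygon (spread≤ : X.last * Y.first ≤ X.first * Y.last) where
        open Weights cρ>0 cρ≤dρ
        open Slopes cρ>0 cρ≤dρ

        cρ*last≤dρ*first : cρ * X.last ≤ dρ * X.first
        cρ*last≤dρ*first = ≡.subst (_≤ dρ * X.first) (ℕP.*-comm X.last cρ)
          (proj₂ (proj₂ (proj₂ (proj₂ ρ))) X.last X.first last∣n first∣m (X.Supp⇒1≤ X.first∈)
            (ρ-admissible {u = X.first} {v = Y.first} {U = X.last} {V = Y.last} first*first≡m last*last≡n spread≤))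

        lastMinimal≼last : PX.w X.lastMinimal ≼ PX.w X.last
        lastMinimal≼last = weight-step {X.minν} {X.ν X.last} {X.first} {X.last} {X.lastMinimal} minν<ν-last cρ*last≤dρ*first (X.first-≤ X.lastMinimal∈)

        last≤lastMinimal : PX.pivot ≡ X.last → X.last ≤ X.lastMinimal
        last≤lastMinimal pivot≡last = ≡.subst (_≤ X.lastMinimal) pivot≡last (PX.pivot-leftmost X.lastMinimal∈
                                 (≡.subst (λ j → PX.w X.lastMinimal ≼ PX.w j) (≡.sym pivot≡last) lastMinimal≼last))

        pivot<last : PX.pivot < X.last
        pivot<last = ℕP.≤∧≢⇒< (X.≤-last PX.pivot∈) λ pivot≡last →
          ℕP.<-irrefl (≡.cong X.ν (ℕP.≤-antisym (X.≤-last X.lastMinimal∈) (last≤lastMinimal pivot≡last))) minν<ν-last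

        A₀ i : ℕ
        A₀ = X.ν PX.pivot + Y.ν PY.pivot
        i = PX.pivot * PY.pivot

        1≤n : 1 ≤ n
        1≤n = ℕP.≤-trans 1≤m (ℕP.<⇒≤ m<n)

        1≤i : 1 ≤ i
        1≤i = ℕP.*-mono-≤ (X.Supp⇒1≤ PX.pivot∈) (Y.Supp⇒1≤ PY.pivot∈)

        a-i≉0 : a i ≉ᴿ 0ᴿ
        a-i≉0 = H≉0⇒a≉0 1≤i (IsVal⇒≉0 {e = A₀} IsVal-H-pivots)

        i<n : i < n
        i<n = ℕP.<-≤-trans (ℕP.*-monoˡ-< PY.pivot {{ℕ.>-nonZero (Y.Supp⇒1≤ PY.pivot∈)}} pivot<last)
                (ℕP.≤-trans (ℕP.*-monoʳ-≤ X.last (Y.≤-last PY.pivot∈)) (ℕP.≤-reflexive last*last≡n))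

        contradiction-at-pivots : ⊥
        contradiction-at-pivots =
          ¬¬-IsVal C≉0 λ (κ , vC) → ¬¬-IsVal a-n≉0 λ (eₙ , va-n) →
          ¬¬-IsVal (a≉0⇒g≉0 a-i≉0) λ (x , vg) → ¬¬-IsVal a-i≉0 λ (y , va) →
            let A₀≡κ+x : A₀ ≡ κ + x
                A₀≡κ+x = IsVal-unique {e = A₀} {f = κ + x} IsVal-H-pivots (IsVal-Cg {κ = κ} {x = x} 1≤i vC vg)
                lasts≡κ+eₙ : X.ν X.last + Y.ν Y.last ≡ κ + eₙ
                lasts≡κ+eₙ = IsVal-unique {e = X.ν X.last + Y.ν Y.last} {f = κ + eₙ}
                               (≡.subst (λ j → IsVal p (H j) (X.ν X.last + Y.ν Y.last)) last*last≡n IsVal-H-last)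
                               (IsVal-Cg {κ = κ} {x = eₙ} 1≤n vC (IsVal-g-n {eₙ} va-n))
                ≼-at-n : weight (κ + x) i ≼ weight (κ + eₙ) n
                ≼-at-n = ≡.subst (λ N → weight (κ + x) i ≼ weight (κ + eₙ) N) last*last≡n
                           (≡.subst₂ (λ A B → weight A i ≼ weight B (X.last * Y.last)) A₀≡κ+x lasts≡κ+eₙ pivots-≼-lasts)
                y≤x : y ≤ x
                y≤x = IsVal-≤ {e = x} {f = y} vg (∣ʳ-trans (proj₁ va) (x∣xy (a i) (b i)))
                y<eₙ , n*c^≤d^*i = weight-≼⇒pow-bound {x} {eₙ} {y} {i} {n} i<n y≤x (weight-cancelˡ κ {x} {eₙ} {i} {n} ≼-at-n)
            in ℕP.<⇒≱ (ρ-bound i y eₙ i<n va va-n y<eₙ) n*c^≤d^*i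

    no-factorisation : ∀ {C} → C ≉ᴿ 0ᴿ → (X Y : Factor) → ∀ {H} →
                       IsDirichletProduct (Factor.coeff X) (Factor.coeff Y) H →
                       (∀ i → 1 ≤ i → H i ≈ᴿ (C · g i)) → ⊥
    no-factorisation C≉0 X Y X⋆Y=H H≈Cg = case ℕP.≤-total (X.last * Y.first) (X.first * Y.last) of λ where
        (inj₁ spreadX≤spreadY) → Factorisation.NewtonPolygon.contradiction-at-pivots C≉0 X Y X⋆Y=H H≈Cg spreadX≤spreadY
        (inj₂ spreadY≤spreadX) → Factorisation.NewtonPolygon.contradiction-at-pivots C≉0 Y X (IsDirichletProduct-comm X⋆Y=H) H≈Cg
                                   (≡.subst₂ _≤_ (ℕP.*-comm X.first Y.last) (ℕP.*-comm X.last Y.first) spreadY≤spreadX)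
      where
        module X = Factor X
        module Y = Factor Y

theorem4p2 : ∀ {c ℓ} (R : CommutativeRing c ℓ) → let open RingDefs R in
    IsUFD →
    (m n : ℕ) → 1 ≤ m → m < n →
    (a : ℕ → Carrier) →
    (∀ j → j < m → a j ≈ᴿ 0ᴿ) → (∀ j → n < j → a j ≈ᴿ 0ᴿ) →
    a m ≉ᴿ 0ᴿ → a n ≉ᴿ 0ᴿ →
    AlgPrimitive m n a →
    (p : Carrier) → Prime p →
    (dδ cδ : ℕ) → IsDelta m n dδ cδ →
    (dρ cρ : ℕ) → IsRho m n dρ cρ →
    (k : ℕ) → k * cδ < m * dδ → p ∤ a k →
    (∀ j → m * dδ ≤ j * cδ → p ∣ a j) →
    (∀ i eᵢ eₙ → i < n → IsVal p (a i) eᵢ → IsVal p (a n) eₙ → eᵢ < eₙ →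
       (dρ ^ (eₙ ∸ eᵢ)) * i < n * (cρ ^ (eₙ ∸ eᵢ))) →
    (b : ℕ → Carrier) → (∀ j → m ≤ j → j ≤ n → b j ≉ᴿ 0ᴿ) → p ∤ (b k · b n) →
    IrreducibleOverQ (λ j → a j · b j)
-- The unused hypothesis k * cδ < m * dδ follows from p ∤ a k and p ∣ a j for m * dδ ≤ j * cδ.
theorem4p2 R ufd m n 1≤m m<n a a-below a-above a-m≉0 a-n≉0 a-primitive p p-prime dδ cδ δ dρ cρ ρ
           k _ p∤a-k p∣a-large ρ-bound b b≉0 p∤b-kb-n
           (F , G , F-poly@(F-valid , _ , NF , F≈0) , G-poly@(G-valid , _ , NG , G≈0) , F-nonconstant , G-nonconstant , g≈F⋆G) =
  ¬¬-polynomialFactor F-poly F/D F-nonconstant λ { (X , ≡.refl) →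
  ¬¬-polynomialFactor G-poly G/E G-nonconstant λ { (Y , ≡.refl) →
  no-factorisation 1≤m m<n a-below a-above a-m≉0 a-n≉0 a-primitive δ ρ p∤a-k p∣a-large ρ-bound b≉0 p∤b-kb-n
    (*-≉0 (den≉0 F/D) (den≉0 G/E)) X Y (⊛-isDirichletProduct (num F/D) (num G/E))
    λ i 1≤i → ι≈⋆⇒⊛≈ F-valid G-valid F/D G/E i (g≈F⋆G i 1≤i) } }
  where
    open UFDValuations R ufd p-prime
    open Factors R ufd p-prime
    open Irreducibility R ufd p-prime
    open DirichletProducts R
    open ClearingDenominators R (proj₁ ufd)
    open OverCommonDenominator

    F/D : OverCommonDenominator F
    F/D = common-denominator F-valid NF F≈0
    G/E : OverCommonDenominator G
    G/E = common-denominator G-valid NG G≈0
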